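{- For $n\ge r\ge1$, the map $\rho:\mathrm{SP}(n,r)\to\mathrm{AS}(n,r)\times S_r$ is a bijection, and if $\rho(\nu)=(\tau,\sigma)$ then $\mathrm{cro}(\nu)=\mathrm{cro}(\tau)+\mathrm{inv}(\sigma)$.
   Context: A signed permutation of $[n]$ is a bijection $\tau$ of $[n]\cup(-[n])$ with $\tau(-i)=-\tau(i)$; $\mathrm{neg}(\tau)=\{i\in[n]:\tau(i)<0\}$. $\mathrm{SP}(n,r)$ is the set of signed permutations with $|\mathrm{neg}(\tau)|=r$ and $1\in\mathrm{neg}(\tau)$; $\mathrm{AS}(n,r)$ is the set of $\tau\in\mathrm{SP}(n,r)$ such that, with $\mathrm{neg}(\tau)=\{d_1<\cdots<d_r\}$, $|\tau(d_1)|<\cdots<|\tau(d_r)|$. $S_r$ is the symmetric group and $\mathrm{inv}(\sigma)$ the number of inversions of $\sigma$. The map $\rho$: for $\nu\in\mathrm{SP}(n,r)$ let $a_1<\cdots<a_r$ be the elements of $\mathrm{neg}(\nu)$ and $b_1<\cdots<b_r$ the elements of $\{|\nu(a_1)|,\dots,|\nu(a_r)|\}$; let $\sigma\in S_r$ be the unique permutation with $\nu(a_j)=-b_{\sigma(j)}$ for all $j$; define $\tau$ by $\tau(a_j)=-b_j$ for $j\in[r]$ and $\tau(i)=\nu(i)$ for $i\notin\mathrm{neg}(\nu)$ (extended by $\tau(-i)=-\tau(i)$); set $\rho(\nu)=(\tau,\sigma)$. Crossings. For a signed permutation $\tau$, define a total order $<_\tau$ on $\mathrm{neg}(\tau)$: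 $i<_\tau j$ iff $\min(i,|\tau(i)|)<\min(j,|\tau(j)|)$, or $\min(i,|\tau(i)|)=i=|\tau(j)|=\min(j,|\tau(j)|)$. Write $\mathrm{neg}(\tau)=\{e_1<_\tau\cdots<_\tau e_r\}$. The arc diagram has points $-r<\cdots<-1<1<\cdots<n$ and, for each $i\in[n]$: if $\tau(i)\ge i$ an upper arc $(i,\tau(i))$; if $0<\tau(i)<i$ a lower arc $(\tau(i),i)$; if $i=e_j$ a lower arc $(-j,i)$ and an upper arc $(-j,|\tau(i)|)$. An upper crossing is a pair of upper arcs $(a,b),(c,d)$ with $a<c\le b<d$; a lower crossing a pair of lower arcs $(a,b),(c,d)$ with $a<c<b<d$; $\mathrm{cro}(\tau)$ is the total number of crossings. -}

module Defs where

open import Data.Nat as ℕ using (ℕ; zero; suc; _⊓_; _≤_; _<_)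
open import Data.Integer as ℤ using (ℤ; +_; -[1+_]; -_; ∣_∣)
open import Data.Fin using (Fin; toℕ)
open import Data.Vec using (Vec; []; _∷_; tabulate)
open import Data.List using (List; []; _∷_; length; map; applyUpTo; concatMap; cartesianProduct)
open import Data.Bool using (Bool; true; false; if_then_else_; _∧_; _∨_; not)
open import Data.Product using (_×_; _,_; ∃)
open import Relation.Binary.PropositionalEquality using (_≡_)

range : ℕ → List ℕ
range n = applyUpTo suc n

filterB : {A : Set} → (A → Bool) → List A → List A
filterB p [] = []
filterB p (x ∷ xs) = if p x then x ∷ filterB p xs else filterB p xs

count : {A : Set} → (A → Bool) → List A → ℕ
count p xs = length (filterB p xs)

memB : ℕ → List ℕ → Bool
memB k [] = false
memB k (x ∷ xs) = (k ℕ.≡ᵇ x) ∨ memB k xs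

-- 1-based access into a list (junk value 0 out of range)
nth : ℕ → List ℕ → ℕ
nth _ [] = 0
nth zero (x ∷ xs) = 0
nth (suc zero) (x ∷ xs) = x
nth (suc (suc k)) (x ∷ xs) = nth (suc k) xs

-- 1-based position of k in a list (junk if absent)
indexOf : ℕ → List ℕ → ℕ
indexOf k [] = 0
indexOf k (x ∷ xs) = if k ℕ.≡ᵇ x then 1 else suc (indexOf k xs)

-- 1-based access into a vector (default value d out of range)
atD : {A : Set} {n : ℕ} → A → Vec A n → ℕ → A
atD d [] _ = d
atD d (x ∷ xs) zero = d
atD d (x ∷ xs) (suc zero) = x
atD d (x ∷ xs) (suc (suc k)) = atD d xs (suc k)

_<ᶻ_ : ℤ → ℤ → Bool
a <ᶻ b = not (b ℤ.≤ᵇ a)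

isNeg : ℤ → Bool
isNeg (+ _) = false
isNeg -[1+ _ ] = true

-- Signed permutations of [n]
-- A signed permutation τ is encoded by the vector (τ(1), …, τ(n)) ∈ ℤⁿ;
-- the values on -[n] are determined by τ(-i) = -τ(i).

val : ∀ {n} → Vec ℤ n → ℕ → ℤ
val = atD (+ 0)

-- τ extends (via τ(-i) = -τ(i)) to a bijection of [n] ∪ (-[n]), i.e.
-- i ↦ |τ(i)| is a bijection of [n].
record IsSignedPerm (n : ℕ) (τ : Vec ℤ n) : Set where
  field
    inRange : ∀ i → 1 ≤ i → i ≤ n → 1 ≤ ∣ val τ i ∣ × ∣ val τ i ∣ ≤ n
    injective : ∀ i j → 1 ≤ i → i ≤ n → 1 ≤ j → j ≤ n →
                ∣ val τ i ∣ ≡ ∣ val τ j ∣ → i ≡ j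
    surjective : ∀ k → 1 ≤ k → k ≤ n →
                 ∃ λ i → 1 ≤ i × i ≤ n × ∣ val τ i ∣ ≡ k

negList : ∀ {n} → Vec ℤ n → List ℕ
negList {n} τ = filterB (λ i → isNeg (val τ i)) (range n)

SP : (n r : ℕ) → Vec ℤ n → Set
SP n r τ = IsSignedPerm n τ × length (negList τ) ≡ r × val τ 1 ℤ.< + 0

AS : (n r : ℕ) → Vec ℤ n → Set
AS n r τ = SP n r τ ×
  (∀ i j → 1 ≤ i → i < j → j ≤ n → val τ i ℤ.< + 0 → val τ j ℤ.< + 0 →
     ∣ val τ i ∣ < ∣ val τ j ∣)

pv : ∀ {r} → Vec ℕ r → ℕ → ℕ
pv = atD 0

record IsPerm (r : ℕ) (σ : Vec ℕ r) : Set where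
  field
    inRange : ∀ i → 1 ≤ i → i ≤ r → 1 ≤ pv σ i × pv σ i ≤ r
    injective : ∀ i j → 1 ≤ i → i ≤ r → 1 ≤ j → j ≤ r →
                pv σ i ≡ pv σ j → i ≡ j
    surjective : ∀ k → 1 ≤ k → k ≤ r →
                 ∃ λ i → 1 ≤ i × i ≤ r × pv σ i ≡ k

inv : ∀ {r} → Vec ℕ r → ℕ
inv {r} σ = count (λ { (i , j) → (i ℕ.<ᵇ j) ∧ (pv σ j ℕ.<ᵇ pv σ i) })
                  (cartesianProduct (range r) (range r))

-- b₁ < ⋯ < b_r : the elements of {|ν(a₁)|, …, |ν(a_r)|}, increasingly
bList : ∀ {n} → Vec ℤ n → List ℕ
bList {n} ν = filterB (λ k → memB k (map (λ a → ∣ val ν a ∣) (negList ν))) (range n)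

-- τ(a_j) = -b_j, τ(i) = ν(i) for i ∉ neg(ν)
ρτ : ∀ {n} → Vec ℤ n → Vec ℤ n
ρτ {n} ν = tabulate λ (p : Fin n) →
  let i = suc (toℕ p) in
  if isNeg (val ν i)
    then - (+ nth (indexOf i (negList ν)) (bList ν))
    else val ν i

-- σ(j) is determined by ν(a_j) = -b_{σ(j)}
ρσ : ∀ {n} (r : ℕ) → Vec ℤ n → Vec ℕ r
ρσ r ν = tabulate λ (q : Fin r) →
  indexOf ∣ val ν (nth (suc (toℕ q)) (negList ν)) ∣ (bList ν)

ρ : (n r : ℕ) → Vec ℤ n → Vec ℤ n × Vec ℕ r
ρ n r ν = ρτ ν , ρσ r ν

key : ∀ {n} → Vec ℤ n → ℕ → ℕ
key τ i = i ⊓ ∣ val τ i ∣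

ltτ : ∀ {n} → Vec ℤ n → ℕ → ℕ → Bool
ltτ τ i j = (key τ i ℕ.<ᵇ key τ j)
  ∨ ((key τ i ℕ.≡ᵇ i) ∧ (i ℕ.≡ᵇ ∣ val τ j ∣) ∧ (∣ val τ j ∣ ℕ.≡ᵇ key τ j))

-- the index j with i = e_j (position of i in neg(τ) ordered by <_τ)
rank : ∀ {n} → Vec ℤ n → ℕ → ℕ
rank τ i = suc (count (λ k → not (k ℕ.≡ᵇ i) ∧ ltτ τ k i) (negList τ))

upperArcs : ∀ {n} → Vec ℤ n → List (ℤ × ℤ)
upperArcs {n} τ = concatMap arcs (range n)
  where
  arcs : ℕ → List (ℤ × ℤ)
  arcs i = if isNeg (val τ i)
             then ((- (+ rank τ i)) , + ∣ val τ i ∣) ∷ []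
             else (if (+ i) ℤ.≤ᵇ val τ i then (+ i , val τ i) ∷ [] else [])

lowerArcs : ∀ {n} → Vec ℤ n → List (ℤ × ℤ)
lowerArcs {n} τ = concatMap arcs (range n)
  where
  arcs : ℕ → List (ℤ × ℤ)
  arcs i = if isNeg (val τ i)
             then ((- (+ rank τ i)) , + i) ∷ []
             else (if ((+ 0) <ᶻ val τ i) ∧ (val τ i <ᶻ (+ i))
                     then (val τ i , + i) ∷ [] else [])

upperCross : (ℤ × ℤ) × (ℤ × ℤ) → Bool
upperCross ((a , b) , (c , d)) = (a <ᶻ c) ∧ (c ℤ.≤ᵇ b) ∧ (b <ᶻ d)

lowerCross : (ℤ × ℤ) × (ℤ × ℤ) → Bool
lowerCross ((a , b) , (c , d)) = (a <ᶻ c) ∧ (c <ᶻ b) ∧ (b <ᶻ d)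

cro : ∀ {n} → Vec ℤ n → ℕ
cro τ = count upperCross (cartesianProduct (upperArcs τ) (upperArcs τ))
      ℕ.+ count lowerCross (cartesianProduct (lowerArcs τ) (lowerArcs τ))

{-# OPTIONS --safe #-}
-- ρ is inverted by ρ⁻¹, which keeps τ off neg(τ) = {a₁ < ⋯ < a_r} and puts -|τ(a_σ(j))| at a_j.
--
-- For the crossings of (τ, σ) = ρ(ν), count those between the arcs of two points i, j ∈ [n]. If i, j ≥ 0 the
-- count is the same for ν and τ. If only i is negative it depends on ν(i) only through |ν(i)|, and |ν|, |τ|
-- take the same values on neg(ν); if only j is negative it is 0. If both are negative, with i = e_(c_i) and
-- j = e_(c_j), the arcs from -c_i and -c_j cross once if c_j < c_i and |t(i)| < |t(j)|, and once if c_j < c_i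
-- and i < j. As i < j and |t(i)| < |t(j)| force c_i < c_j, the two orders of a pair {i, j} contribute 1 in
-- total if i ↦ |t(i)| inverts it and 0 otherwise. So these crossings count the inversions of |t| on neg(t):
-- none for τ ∈ AS(n,r), and inv(σ) for ν, since |ν(a_j)| = b_σ(j).
module Submission where

open import Defs
open import Data.Nat using (ℕ; _≤_; _+_)
open import Data.Integer using (ℤ)
open import Data.Vec using (Vec)
open import Data.Product using (_×_; _,_; ∃; proj₁; proj₂)
open import Relation.Binary.PropositionalEquality using (_≡_)

open import Data.Bool using (Bool; true; false; if_then_else_; _∧_; not; T)
open import Data.Bool.Properties using (∧-conicalˡ; ∧-conicalʳ)
open import Data.Empty using (⊥-elim)
open import Data.Fin using (Fin; toℕ)
open import Data.Integer as ℤ using (-[1+_]; -_; ∣_∣; -<+; +<+)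
open import Data.Integer.Properties using (∣-i∣≡∣i∣)
open import Data.Maybe using (Maybe; just; nothing)
open import Data.List using (List; []; _∷_; length; map; applyUpTo; concatMap; cartesianProduct; _++_)
open import Data.List.Membership.Propositional using (_∈_)
open import Data.List.Properties using (length-map)
open import Data.List.Membership.Propositional.Properties using (∈-map⁺; ∈-map⁻; ∈-applyUpTo⁺; ∈-applyUpTo⁻)
open import Data.List.Relation.Binary.Subset.Propositional using (_⊆_)
open import Data.List.Relation.Unary.All as All using (All; []; _∷_)
open import Data.List.Relation.Unary.AllPairs as AllPairs using (AllPairs; []; _∷_)
open import Data.List.Relation.Unary.Any using (here; there)
open import Data.List.Relation.Unary.Unique.Propositional using (Unique)
open import Data.Nat using (zero; suc; _<_; z≤n; s≤s; z<s; s<s; _<ᵇ_; _≡ᵇ_; _≤ᵇ_; pred)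
open import Data.Nat.Properties
open import Algebra.Properties.CommutativeSemigroup +-commutativeSemigroup using (interchange)
open import Data.Sum using (_⊎_; inj₁; inj₂)
open import Data.Vec using (tabulate) renaming ([] to []ᵥ; _∷_ to _∷ᵥ_)
open import Function using (_∘_)
open import Relation.Binary.Definitions using (tri<; tri≈; tri>)
open import Relation.Binary.PropositionalEquality using (refl; sym; trans; cong; cong₂; subst; subst₂; _≢_; module ≡-Reasoning)
open import Relation.Nullary using (¬_; yes; no)

true≢false : true ≢ false
true≢false ()

<ᵇ-true : ∀ {m n} → m < n → (m <ᵇ n) ≡ true
<ᵇ-true {m} {n} m<n with m <ᵇ n | <⇒<ᵇ m<n
... | true | _ = refl

<ᵇ-false : ∀ {m n} → n ≤ m → (m <ᵇ n) ≡ false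
<ᵇ-false {m} {n} n≤m with m <ᵇ n in eq
... | false = refl
... | true = ⊥-elim (<⇒≱ (<ᵇ⇒< m n (subst T (sym eq) _)) n≤m)

<ᵇ-sound : ∀ {m n} → (m <ᵇ n) ≡ true → m < n
<ᵇ-sound {m} {n} eq = <ᵇ⇒< m n (subst T (sym eq) _)

<ᵇ-irrefl : ∀ m → (m <ᵇ m) ≡ false
<ᵇ-irrefl m = <ᵇ-false {m} ≤-refl

≡ᵇ-true : ∀ {m n} → m ≡ n → (m ≡ᵇ n) ≡ true
≡ᵇ-true {m} {n} m≡n with m ≡ᵇ n | ≡⇒≡ᵇ m n m≡n
... | true | _ = refl

≡ᵇ-false : ∀ {m n} → m ≢ n → (m ≡ᵇ n) ≡ false
≡ᵇ-false {m} {n} m≢n with m ≡ᵇ n in eq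
... | false = refl
... | true = ⊥-elim (m≢n (≡ᵇ⇒≡ m n (subst T (sym eq) _)))

≡ᵇ-sound : ∀ {m n} → (m ≡ᵇ n) ≡ true → m ≡ n
≡ᵇ-sound {m} {n} eq = ≡ᵇ⇒≡ m n (subst T (sym eq) _)

≤ᵇ-true : ∀ {m n} → m ≤ n → (m ≤ᵇ n) ≡ true
≤ᵇ-true {m} {n} m≤n with m ≤ᵇ n | ≤⇒≤ᵇ m≤n
... | true | _ = refl

≤ᵇ-sound : ∀ {m n} → (m ≤ᵇ n) ≡ true → m ≤ n
≤ᵇ-sound {m} {n} eq = ≤ᵇ⇒≤ m n (subst T (sym eq) _)

not-≤ᵇ : ∀ m n → not (m ≤ᵇ n) ≡ (n <ᵇ m)
not-≤ᵇ m n with ≤-<-connex m n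
... | inj₁ m≤n rewrite ≤ᵇ-true m≤n = sym (<ᵇ-false m≤n)
not-≤ᵇ (suc m) n | inj₂ (s≤s n≤m) rewrite <ᵇ-false n≤m = sym (<ᵇ-true (s≤s n≤m))

⇔-≡ : ∀ {a b} → (a ≡ true → b ≡ true) → (b ≡ true → a ≡ true) → a ≡ b
⇔-≡ {false} {false} _ _ = refl
⇔-≡ {false} {true} _ b⇒a = b⇒a refl
⇔-≡ {true} {false} a⇒b _ = sym (a⇒b refl)
⇔-≡ {true} {true} _ _ = refl

-- Finite sums and indicators

_when_ : ℕ → Bool → ℕ
m when true = m
m when false = 0

𝟙 : Bool → ℕ
𝟙 b = 1 when b

∑ : {A : Set} → List A → (A → ℕ) → ℕ
∑ [] f = 0
∑ (x ∷ xs) f = f x + ∑ xs f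

syntax ∑ xs (λ x → e) = ∑[ x ∈ xs ] e

module _ {A : Set} where

  ∑-cong : (xs : List A) {f g : A → ℕ} → (∀ {x} → x ∈ xs → f x ≡ g x) → ∑ xs f ≡ ∑ xs g
  ∑-cong [] f≡g = refl
  ∑-cong (x ∷ xs) f≡g = cong₂ _+_ (f≡g (here refl)) (∑-cong xs (f≡g ∘ there))

  ∑-++ : (xs ys : List A) (f : A → ℕ) → ∑ (xs ++ ys) f ≡ ∑ xs f + ∑ ys f
  ∑-++ [] ys f = refl
  ∑-++ (x ∷ xs) ys f = trans (cong (f x +_) (∑-++ xs ys f)) (sym (+-assoc (f x) _ _))

  ∑-zero : (xs : List A) → ∑[ x ∈ xs ] 0 ≡ 0
  ∑-zero [] = refl
  ∑-zero (x ∷ xs) = ∑-zero xs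

  ∑-distrib-+ : (xs : List A) (f g : A → ℕ) → ∑[ x ∈ xs ] (f x + g x) ≡ ∑ xs f + ∑ xs g
  ∑-distrib-+ [] f g = refl
  ∑-distrib-+ (x ∷ xs) f g =
    trans (cong (f x + g x +_) (∑-distrib-+ xs f g)) (interchange (f x) (g x) (∑ xs f) (∑ xs g))

  ∑-when : (xs : List A) (b : Bool) (f : A → ℕ) → ∑[ x ∈ xs ] (f x when b) ≡ ∑ xs f when b
  ∑-when xs true f = refl
  ∑-when xs false f = ∑-zero xs

  ∑-mono-≤ : (xs : List A) {f g : A → ℕ} → (∀ {x} → x ∈ xs → f x ≤ g x) → ∑ xs f ≤ ∑ xs g
  ∑-mono-≤ [] f≤g = z≤n
  ∑-mono-≤ (x ∷ xs) f≤g = +-mono-≤ (f≤g (here refl)) (∑-mono-≤ xs (f≤g ∘ there))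

  ∑-mono-< : (xs : List A) {f g : A → ℕ} → (∀ {x} → x ∈ xs → f x ≤ g x) →
             ∀ {y} → y ∈ xs → f y < g y → ∑ xs f < ∑ xs g
  ∑-mono-< (x ∷ xs) f≤g (here refl) fy<gy = +-mono-<-≤ fy<gy (∑-mono-≤ xs (f≤g ∘ there))
  ∑-mono-< (x ∷ xs) f≤g (there y∈xs) fy<gy =
    +-mono-≤-< (f≤g (here refl)) (∑-mono-< xs (f≤g ∘ there) y∈xs fy<gy)

  length≡∑1 : (xs : List A) → length xs ≡ ∑[ x ∈ xs ] 1
  length≡∑1 [] = refl
  length≡∑1 (x ∷ xs) = cong suc (length≡∑1 xs)

  count≡∑ : (p : A → Bool) (xs : List A) → count p xs ≡ ∑[ x ∈ xs ] 𝟙 (p x)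
  count≡∑ p [] = refl
  count≡∑ p (x ∷ xs) with p x
  ... | true = cong suc (count≡∑ p xs)
  ... | false = count≡∑ p xs

  ∑-filterB : (p : A → Bool) (xs : List A) (f : A → ℕ) → ∑ (filterB p xs) f ≡ ∑[ x ∈ xs ] (f x when p x)
  ∑-filterB p [] f = refl
  ∑-filterB p (x ∷ xs) f with p x
  ... | true = cong (f x +_) (∑-filterB p xs f)
  ... | false = ∑-filterB p xs f

∑-map : {A B : Set} (g : A → B) (xs : List A) (f : B → ℕ) → ∑ (map g xs) f ≡ ∑[ x ∈ xs ] f (g x)
∑-map g [] f = refl
∑-map g (x ∷ xs) f = cong (f (g x) +_) (∑-map g xs f)

∑-concatMap : {A B : Set} (g : A → List B) (xs : List A) (f : B → ℕ) →
              ∑ (concatMap g xs) f ≡ ∑[ x ∈ xs ] ∑ (g x) f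
∑-concatMap g [] f = refl
∑-concatMap g (x ∷ xs) f =
  trans (∑-++ (g x) (concatMap g xs) f) (cong (∑ (g x) f +_) (∑-concatMap g xs f))

∑-cartesianProduct : {A B : Set} (xs : List A) (ys : List B) (f : A × B → ℕ) →
                     ∑ (cartesianProduct xs ys) f ≡ ∑[ x ∈ xs ] ∑[ y ∈ ys ] f (x , y)
∑-cartesianProduct [] ys f = refl
∑-cartesianProduct (x ∷ xs) ys f =
  trans (∑-++ (map (x ,_) ys) _ f) (cong₂ _+_ (∑-map (x ,_) ys f) (∑-cartesianProduct xs ys f))

∑-comm : {A B : Set} (xs : List A) (ys : List B) (f : A → B → ℕ) →
         ∑[ x ∈ xs ] ∑[ y ∈ ys ] f x y ≡ ∑[ y ∈ ys ] ∑[ x ∈ xs ] f x y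
∑-comm [] ys f = sym (∑-zero ys)
∑-comm (x ∷ xs) ys f =
  trans (cong (∑ ys (f x) +_) (∑-comm xs ys f)) (sym (∑-distrib-+ ys (f x) (λ y → ∑[ x ∈ xs ] f x y)))

∑∑-distrib-+ : {A : Set} (xs : List A) (f g : A → A → ℕ) →
               ∑[ x ∈ xs ] ∑[ y ∈ xs ] (f x y + g x y) ≡ ∑[ x ∈ xs ] ∑ xs (f x) + ∑[ x ∈ xs ] ∑ xs (g x)
∑∑-distrib-+ xs f g = trans (∑-cong xs (λ {x} _ → ∑-distrib-+ xs (f x) (g x))) (∑-distrib-+ xs _ _)

𝟙-mono : ∀ {a b} → (a ≡ true → b ≡ true) → 𝟙 a ≤ 𝟙 b
𝟙-mono {false} _ = z≤n
𝟙-mono {true} a⇒b rewrite a⇒b refl = ≤-refl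

double-injective : ∀ {a b} → a + a ≡ b + b → a ≡ b
double-injective {a} {b} a+a≡b+b with <-cmp a b
... | tri< a<b _ _ = ⊥-elim (<-irrefl a+a≡b+b (+-mono-< a<b a<b))
... | tri≈ _ a≡b _ = a≡b
... | tri> _ _ b<a = ⊥-elim (<-irrefl (sym a+a≡b+b) (+-mono-< b<a b<a))

InjectiveOn : List ℕ → (ℕ → ℕ) → Set
InjectiveOn xs K = ∀ {i j} → i ∈ xs → j ∈ xs → K i ≡ K j → i ≡ j

module _ (xs : List ℕ) (Q : ℕ → ℕ → ℕ) (Q-sym : ∀ i j → Q i j ≡ Q j i) where

  ∑-below : (ℕ → ℕ) → ℕ
  ∑-below K = ∑[ i ∈ xs ] ∑[ j ∈ xs ] (Q i j when (K j <ᵇ K i))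

  private
    ∑-offDiagonal : ℕ
    ∑-offDiagonal = ∑[ i ∈ xs ] ∑[ j ∈ xs ] (Q i j when not (i ≡ᵇ j))

    below+above : ∀ K → InjectiveOn xs K → ∀ {i j} → i ∈ xs → j ∈ xs →
                  (Q i j when (K j <ᵇ K i)) + (Q i j when (K i <ᵇ K j)) ≡ Q i j when not (i ≡ᵇ j)
    below+above K K-inj {i} {j} i∈xs j∈xs with <-cmp (K j) (K i)
    ... | tri< Kj<Ki _ _ rewrite <ᵇ-true Kj<Ki | <ᵇ-false (<⇒≤ Kj<Ki)
                               | ≡ᵇ-false {i} {j} (λ i≡j → <-irrefl (cong K (sym i≡j)) Kj<Ki) = +-identityʳ _
    ... | tri> _ _ Ki<Kj rewrite <ᵇ-true Ki<Kj | <ᵇ-false (<⇒≤ Ki<Kj)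
                               | ≡ᵇ-false {i} {j} (λ i≡j → <-irrefl (cong K i≡j) Ki<Kj) = refl
    ... | tri≈ _ Kj≡Ki _ with K-inj j∈xs i∈xs Kj≡Ki
    ... | refl rewrite <ᵇ-irrefl (K i) | ≡ᵇ-true {i} refl = refl

    ∑-below-twice : ∀ K → InjectiveOn xs K → ∑-below K + ∑-below K ≡ ∑-offDiagonal
    ∑-below-twice K K-inj = begin
      ∑-below K + ∑-below K
        ≡⟨ cong (∑-below K +_) above≡below ⟨
      ∑-below K + ∑[ i ∈ xs ] ∑[ j ∈ xs ] (Q i j when (K i <ᵇ K j))
        ≡⟨ ∑∑-distrib-+ xs _ _ ⟨
      ∑[ i ∈ xs ] ∑[ j ∈ xs ] ((Q i j when (K j <ᵇ K i)) + (Q i j when (K i <ᵇ K j)))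
        ≡⟨ ∑-cong xs (λ i∈xs → ∑-cong xs (λ j∈xs → below+above K K-inj i∈xs j∈xs)) ⟩
      ∑-offDiagonal ∎
      where
      open ≡-Reasoning
      above≡below : ∑[ i ∈ xs ] ∑[ j ∈ xs ] (Q i j when (K i <ᵇ K j)) ≡ ∑-below K
      above≡below = trans (∑-comm xs xs _)
        (∑-cong xs (λ {j} _ → ∑-cong xs (λ {i} _ → cong (_when (K i <ᵇ K j)) (Q-sym i j))))

  ∑-below-orderIndependent : ∀ K K′ → InjectiveOn xs K → InjectiveOn xs K′ → ∑-below K ≡ ∑-below K′
  ∑-below-orderIndependent K K′ K-inj K′-inj =
    double-injective (trans (∑-below-twice K K-inj) (sym (∑-below-twice K′ K′-inj)))

_∈[1,_] : ℕ → ℕ → Set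
i ∈[1, n ] = 1 ≤ i × i ≤ n

Increasing : List ℕ → Set
Increasing = AllPairs _<_

Increasing⇒Unique : ∀ {xs} → Increasing xs → Unique xs
Increasing⇒Unique = AllPairs.map (λ x<y x≡y → <-irrefl x≡y x<y)

Unique-map : ∀ {xs} (f : ℕ → ℕ) → InjectiveOn xs f → Unique xs → Unique (map f xs)
Unique-map f f-inj [] = []
Unique-map f f-inj (x∉xs ∷ xs!) = All.tabulate fx∉ ∷ Unique-map f (λ i∈ j∈ → f-inj (there i∈) (there j∈)) xs!
  where
  fx∉ : ∀ {y} → y ∈ map f _ → f _ ≢ y
  fx∉ y∈ fx≡y with ∈-map⁻ f y∈
  ... | z , z∈xs , refl = All.lookup x∉xs z∈xs (f-inj (here refl) (there z∈xs) fx≡y)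

Increasing-map : ∀ {xs} (f : ℕ → ℕ) → (∀ {x y} → x ∈ xs → y ∈ xs → x < y → f x < f y) →
                 Increasing xs → Increasing (map f xs)
Increasing-map f f-mono [] = []
Increasing-map f f-mono (x<xs ∷ xs↑) =
  All.tabulate fx< ∷ Increasing-map f (λ x∈ y∈ → f-mono (there x∈) (there y∈)) xs↑
  where
  fx< : ∀ {y} → y ∈ map f _ → f _ < y
  fx< y∈ with ∈-map⁻ f y∈
  ... | z , z∈xs , refl = f-mono (here refl) (there z∈xs) (All.lookup x<xs z∈xs)

∈-tail : ∀ {x z xs ys} → All (x <_) xs → z ∈ xs → z ∈ x ∷ ys → z ∈ ys
∈-tail x<xs z∈xs (here refl) = ⊥-elim (<-irrefl refl (All.lookup x<xs z∈xs))
∈-tail _ _ (there z∈ys) = z∈ys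

heads-≡ : ∀ {x y xs ys} → All (x <_) xs → All (y <_) ys → x ∈ y ∷ ys → y ∈ x ∷ xs → x ≡ y
heads-≡ _ _ (here x≡y) _ = x≡y
heads-≡ _ _ (there _) (here y≡x) = sym y≡x
heads-≡ x<xs y<ys (there x∈ys) (there y∈xs) = ⊥-elim (<-asym (All.lookup x<xs y∈xs) (All.lookup y<ys x∈ys))

Increasing-⊆-antisym : ∀ {xs ys} → Increasing xs → Increasing ys → xs ⊆ ys → ys ⊆ xs → xs ≡ ys
Increasing-⊆-antisym [] [] _ _ = refl
Increasing-⊆-antisym [] (_ ∷ _) _ ys⊆[] with ys⊆[] (here refl)
... | ()
Increasing-⊆-antisym (_ ∷ _) [] xs⊆[] _ with xs⊆[] (here refl)
... | ()
Increasing-⊆-antisym (x<xs ∷ xs↑) (y<ys ∷ ys↑) xs⊆ys ys⊆xs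
  with refl ← heads-≡ x<xs y<ys (xs⊆ys (here refl)) (ys⊆xs (here refl))
  = cong (_ ∷_) (Increasing-⊆-antisym xs↑ ys↑ (λ z∈xs → ∈-tail x<xs z∈xs (xs⊆ys (there z∈xs)))
                                              (λ z∈ys → ∈-tail y<ys z∈ys (ys⊆xs (there z∈ys))))

module _ {A : Set} (p : A → Bool) where

  ∈-filterB⁻ : ∀ {x} xs → x ∈ filterB p xs → x ∈ xs × p x ≡ true
  ∈-filterB⁻ (y ∷ ys) x∈ with p y in py
  ∈-filterB⁻ (y ∷ ys) (here refl) | true = here refl , py
  ∈-filterB⁻ (y ∷ ys) (there x∈) | true = let x∈ys , px = ∈-filterB⁻ ys x∈ in there x∈ys , px
  ∈-filterB⁻ (y ∷ ys) x∈ | false = let x∈ys , px = ∈-filterB⁻ ys x∈ in there x∈ys , px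

  ∈-filterB⁺ : ∀ {x xs} → x ∈ xs → p x ≡ true → x ∈ filterB p xs
  ∈-filterB⁺ {xs = y ∷ ys} (here refl) px rewrite px = here refl
  ∈-filterB⁺ {xs = y ∷ ys} (there x∈ys) px with p y
  ... | true = there (∈-filterB⁺ x∈ys px)
  ... | false = ∈-filterB⁺ x∈ys px

  All-filterB : ∀ {P : A → Set} {xs} → All P xs → All P (filterB p xs)
  All-filterB [] = []
  All-filterB {xs = y ∷ _} (py ∷ pys) with p y
  ... | true = py ∷ All-filterB pys
  ... | false = All-filterB pys

  AllPairs-filterB : ∀ {R : A → A → Set} {xs} → AllPairs R xs → AllPairs R (filterB p xs)
  AllPairs-filterB [] = []
  AllPairs-filterB {xs = y ∷ _} (Ry ∷ Rys) with p y
  ... | true = All-filterB Ry ∷ AllPairs-filterB Rys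
  ... | false = AllPairs-filterB Rys

filterB-cong : {A : Set} {p q : A → Bool} (xs : List A) → (∀ {x} → x ∈ xs → p x ≡ q x) →
               filterB p xs ≡ filterB q xs
filterB-cong [] _ = refl
filterB-cong {q = q} (x ∷ xs) p≡q rewrite p≡q (here refl) with q x
... | true = cong (x ∷_) (filterB-cong xs (p≡q ∘ there))
... | false = filterB-cong xs (p≡q ∘ there)

∈⇒memB : ∀ {k} xs → k ∈ xs → memB k xs ≡ true
∈⇒memB {k} (x ∷ xs) (here refl) rewrite ≡ᵇ-true {k} refl = refl
∈⇒memB {k} (x ∷ xs) (there k∈xs) rewrite ∈⇒memB xs k∈xs with k ≡ᵇ x
... | true = refl
... | false = refl

memB⇒∈ : ∀ {k} xs → memB k xs ≡ true → k ∈ xs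
memB⇒∈ {k} (x ∷ xs) mem with k ≡ᵇ x in k≡x
... | true = here (≡ᵇ-sound k≡x)
... | false = there (memB⇒∈ xs mem)

∉⇒memB : ∀ {k} xs → ¬ k ∈ xs → memB k xs ≡ false
∉⇒memB {k} xs k∉xs with memB k xs in mem
... | true = ⊥-elim (k∉xs (memB⇒∈ xs mem))
... | false = refl

∑-delta : ∀ {x} xs (g : ℕ → ℕ) → Unique xs → x ∈ xs → ∑[ k ∈ xs ] (g k when (k ≡ᵇ x)) ≡ g x
∑-delta {x} (x ∷ xs) g (x∉xs ∷ _) (here refl) rewrite ≡ᵇ-true {x} refl = begin
  g x + ∑[ k ∈ xs ] (g k when (k ≡ᵇ x)) ≡⟨ cong (g x +_) (trans (∑-cong xs k≢x) (∑-zero xs)) ⟩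
  g x + 0                                ≡⟨ +-identityʳ (g x) ⟩
  g x                                    ∎
  where
  open ≡-Reasoning
  k≢x : ∀ {k} → k ∈ xs → g k when (k ≡ᵇ x) ≡ 0
  k≢x k∈xs rewrite ≡ᵇ-false (λ k≡x → All.lookup x∉xs k∈xs (sym k≡x)) = refl
∑-delta {x} (y ∷ xs) g (y∉xs ∷ xs!) (there x∈xs)
  rewrite ≡ᵇ-false {y} {x} (λ y≡x → All.lookup y∉xs x∈xs y≡x) = ∑-delta xs g xs! x∈xs

∑-memB : ∀ xs ys (g : ℕ → ℕ) → Unique xs → Unique ys → ys ⊆ xs →
         ∑[ k ∈ xs ] (g k when memB k ys) ≡ ∑ ys g
∑-memB xs [] g _ _ _ = ∑-zero xs
∑-memB xs (y ∷ ys) g xs! (y∉ys ∷ ys!) y∷ys⊆xs = begin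
  ∑[ k ∈ xs ] (g k when memB k (y ∷ ys))
    ≡⟨ ∑-cong xs (λ {k} _ → split k) ⟩
  ∑[ k ∈ xs ] ((g k when (k ≡ᵇ y)) + (g k when memB k ys))
    ≡⟨ ∑-distrib-+ xs _ _ ⟩
  ∑[ k ∈ xs ] (g k when (k ≡ᵇ y)) + ∑[ k ∈ xs ] (g k when memB k ys)
    ≡⟨ cong₂ _+_ (∑-delta xs g xs! (y∷ys⊆xs (here refl))) (∑-memB xs ys g xs! ys! (y∷ys⊆xs ∘ there)) ⟩
  g y + ∑ ys g ∎
  where
  open ≡-Reasoning
  split : ∀ k → g k when memB k (y ∷ ys) ≡ (g k when (k ≡ᵇ y)) + (g k when memB k ys)
  split k with k ≡ᵇ y in k≡y
  ... | false = refl
  ... | true with refl ← ≡ᵇ-sound {k} k≡y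
             rewrite ∉⇒memB ys (λ k∈ys → All.lookup y∉ys k∈ys refl) = sym (+-identityʳ (g k))

∈-range⁻ : ∀ n {k} → k ∈ range n → k ∈[1, n ]
∈-range⁻ n k∈ with ∈-applyUpTo⁻ suc k∈
... | _ , i<n , refl = s≤s z≤n , i<n

∈-range⁺ : ∀ n {k} → k ∈[1, n ] → k ∈ range n
∈-range⁺ n {suc k} (_ , k<n) = ∈-applyUpTo⁺ suc k<n

Increasing-applyUpTo : ∀ (f : ℕ → ℕ) n → (∀ {i j} → i < j → f i < f j) → Increasing (applyUpTo f n)
Increasing-applyUpTo f zero _ = []
Increasing-applyUpTo f (suc n) f-mono =
  All.tabulate f0<fi ∷ Increasing-applyUpTo (f ∘ suc) n (f-mono ∘ s<s)
  where
  f0<fi : ∀ {x} → x ∈ applyUpTo (f ∘ suc) n → f 0 < x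
  f0<fi x∈ with ∈-applyUpTo⁻ (f ∘ suc) x∈
  ... | _ , _ , refl = f-mono z<s

Increasing-range : ∀ n → Increasing (range n)
Increasing-range n = Increasing-applyUpTo suc n s<s

Unique-range : ∀ n → Unique (range n)
Unique-range n = Increasing⇒Unique (Increasing-range n)

nth-suc : ∀ {q} x xs → 1 ≤ q → nth (suc q) (x ∷ xs) ≡ nth q xs
nth-suc x xs (s≤s z≤n) = refl

nth-∈ : ∀ {q} xs → q ∈[1, length xs ] → nth q xs ∈ xs
nth-∈ {1} (x ∷ xs) _ = here refl
nth-∈ {suc (suc q)} (x ∷ xs) (_ , s≤s q<) = there (nth-∈ xs (s≤s z≤n , q<))

nth-map : ∀ (f : ℕ → ℕ) {q} xs → q ∈[1, length xs ] → nth q (map f xs) ≡ f (nth q xs)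
nth-map f {1} (x ∷ xs) _ = refl
nth-map f {suc (suc q)} (x ∷ xs) (_ , s≤s q<) = nth-map f xs (s≤s z≤n , q<)

indexOf-∈[1,length] : ∀ {x} xs → x ∈ xs → indexOf x xs ∈[1, length xs ]
indexOf-∈[1,length] (x ∷ xs) (here refl) rewrite ≡ᵇ-true {x} refl = s≤s z≤n , s≤s z≤n
indexOf-∈[1,length] {x} (y ∷ xs) (there x∈xs) with x ≡ᵇ y
... | true = s≤s z≤n , s≤s z≤n
... | false = s≤s z≤n , s≤s (proj₂ (indexOf-∈[1,length] xs x∈xs))

nth-indexOf : ∀ {x} xs → x ∈ xs → nth (indexOf x xs) xs ≡ x
nth-indexOf (x ∷ xs) (here refl) rewrite ≡ᵇ-true {x} refl = refl
nth-indexOf {x} (y ∷ xs) (there x∈xs) with x ≡ᵇ y in x≡y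
... | true = sym (≡ᵇ-sound x≡y)
... | false = trans (nth-suc y xs (proj₁ (indexOf-∈[1,length] xs x∈xs))) (nth-indexOf xs x∈xs)

indexOf-nth : ∀ {q} xs → Unique xs → q ∈[1, length xs ] → indexOf (nth q xs) xs ≡ q
indexOf-nth {1} (x ∷ xs) _ _ rewrite ≡ᵇ-true {x} refl = refl
indexOf-nth {suc (suc q)} (x ∷ xs) (x∉xs ∷ xs!) (_ , s≤s q<)
  rewrite ≡ᵇ-false (λ y≡x → All.lookup x∉xs (nth-∈ xs (s≤s z≤n , q<)) (sym y≡x))
  = cong suc (indexOf-nth xs xs! (s≤s z≤n , q<))

nth-injective : ∀ {q q′} xs → Unique xs → q ∈[1, length xs ] → q′ ∈[1, length xs ] →
                nth q xs ≡ nth q′ xs → q ≡ q′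
nth-injective {q} {q′} xs xs! q∈ q′∈ eq =
  trans (sym (indexOf-nth xs xs! q∈)) (trans (cong (λ x → indexOf x xs) eq) (indexOf-nth xs xs! q′∈))

nth-strictMono : ∀ {q q′} xs → Increasing xs → 1 ≤ q → q < q′ → q′ ≤ length xs → nth q xs < nth q′ xs
nth-strictMono {1} {1} _ _ _ (s≤s ()) _
nth-strictMono {1} {suc (suc q′)} (x ∷ xs) (x<xs ∷ _) _ _ (s≤s q′<) = All.lookup x<xs (nth-∈ xs (s≤s z≤n , q′<))
nth-strictMono {suc (suc q)} {suc (suc q′)} (x ∷ xs) (_ ∷ xs↑) _ (s<s q<q′) (s≤s q′<) =
  nth-strictMono xs xs↑ (s≤s z≤n) q<q′ q′<

nth-<ᵇ : ∀ {q q′} xs → Increasing xs → q ∈[1, length xs ] → q′ ∈[1, length xs ] →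
         (nth q xs <ᵇ nth q′ xs) ≡ (q <ᵇ q′)
nth-<ᵇ {q} {q′} xs xs↑ (1≤q , q≤) (1≤q′ , q′≤) with <-cmp q q′
... | tri< q<q′ _ _ = trans (<ᵇ-true (nth-strictMono xs xs↑ 1≤q q<q′ q′≤)) (sym (<ᵇ-true q<q′))
... | tri≈ _ refl _ = trans (<ᵇ-irrefl (nth q xs)) (sym (<ᵇ-irrefl q))
... | tri> _ _ q′<q = trans (<ᵇ-false (<⇒≤ (nth-strictMono xs xs↑ 1≤q′ q′<q q≤))) (sym (<ᵇ-false (<⇒≤ q′<q)))

indexOf-<ᵇ : ∀ {x y} xs → Increasing xs → x ∈ xs → y ∈ xs → (indexOf x xs <ᵇ indexOf y xs) ≡ (x <ᵇ y)
indexOf-<ᵇ xs xs↑ x∈ y∈ =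
  trans (sym (nth-<ᵇ xs xs↑ (indexOf-∈[1,length] xs x∈) (indexOf-∈[1,length] xs y∈)))
        (cong₂ _<ᵇ_ (nth-indexOf xs x∈) (nth-indexOf xs y∈))

∑-reindex : ∀ xs (f : ℕ → ℕ) → ∑ xs f ≡ ∑[ q ∈ range (length xs) ] f (nth q xs)
∑-reindex xs f = begin
  ∑ xs f                                                   ≡⟨ cong (λ ys → ∑ ys f) (tabulated xs) ⟩
  ∑ (applyUpTo (λ i → nth (suc i) xs) (length xs)) f       ≡⟨ cong (λ ys → ∑ ys f) (applyUpTo-∘ (length xs)) ⟩
  ∑ (map (λ q → nth q xs) (range (length xs))) f           ≡⟨ ∑-map (λ q → nth q xs) (range (length xs)) f ⟩
  ∑[ q ∈ range (length xs) ] f (nth q xs)                  ∎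
  where
  open ≡-Reasoning
  tabulated : ∀ ys → ys ≡ applyUpTo (λ i → nth (suc i) ys) (length ys)
  tabulated [] = refl
  tabulated (y ∷ ys) = cong (y ∷_) (tabulated ys)
  applyUpTo-∘ : ∀ {g : ℕ → ℕ} m → applyUpTo (λ i → nth (g i) xs) m ≡ map (λ q → nth q xs) (applyUpTo g m)
  applyUpTo-∘ zero = refl
  applyUpTo-∘ (suc m) = cong (_ ∷_) (applyUpTo-∘ m)

atD-tabulate : ∀ {A : Set} (d : A) {n} (g : ℕ → A) {i} → i ∈[1, n ] →
               atD d (tabulate {n = n} (λ p → g (suc (toℕ p)))) i ≡ g i
atD-tabulate d {suc n} g {1} _ = refl
atD-tabulate d {suc n} g {suc (suc i)} (_ , s≤s i<n) = atD-tabulate d (g ∘ suc) (s≤s z≤n , i<n)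

atD-ext : ∀ {A : Set} (d : A) {n} (u w : Vec A n) → (∀ {i} → i ∈[1, n ] → atD d u i ≡ atD d w i) → u ≡ w
atD-ext d []ᵥ []ᵥ _ = refl
atD-ext d (x ∷ᵥ u) (y ∷ᵥ w) u≗w = cong₂ _∷ᵥ_ (u≗w (s≤s z≤n , s≤s z≤n))
  (atD-ext d u w (λ { {suc i} (_ , i≤n) → u≗w (s≤s z≤n , s≤s i≤n) }))

isNeg⇒<0 : ∀ {x} → isNeg x ≡ true → x ℤ.< ℤ.+ 0
isNeg⇒<0 { -[1+ _ ]} _ = -<+

<0⇒isNeg : ∀ {x} → x ℤ.< ℤ.+ 0 → isNeg x ≡ true
<0⇒isNeg -<+ = refl

isNeg⇒≡-∣∣ : ∀ {x} → isNeg x ≡ true → - (ℤ.+ ∣ x ∣) ≡ x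
isNeg⇒≡-∣∣ { -[1+ _ ]} _ = refl

isNeg-negate : ∀ {m} → 1 ≤ m → isNeg (- (ℤ.+ m)) ≡ true
isNeg-negate (s≤s _) = refl

∣-+∣ : ∀ m → ∣ - (ℤ.+ m) ∣ ≡ m
∣-+∣ m = ∣-i∣≡∣i∣ (ℤ.+ m)

module _ {n} (t : Vec ℤ n) where

  ∈-negList⁻ : ∀ {i} → i ∈ negList t → i ∈[1, n ] × isNeg (val t i) ≡ true
  ∈-negList⁻ i∈ = let i∈range , neg = ∈-filterB⁻ _ (range n) i∈ in ∈-range⁻ n i∈range , neg

  ∈-negList⁺ : ∀ {i} → i ∈[1, n ] → isNeg (val t i) ≡ true → i ∈ negList t
  ∈-negList⁺ i∈[1,n] neg = ∈-filterB⁺ _ (∈-range⁺ n i∈[1,n]) neg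

  Increasing-negList : Increasing (negList t)
  Increasing-negList = AllPairs-filterB _ (Increasing-range n)

  ∈-bList⁻ : ∀ {k} → k ∈ bList t → ∃ λ a → a ∈ negList t × k ≡ ∣ val t a ∣
  ∈-bList⁻ k∈ = ∈-map⁻ (λ a → ∣ val t a ∣) (memB⇒∈ _ (proj₂ (∈-filterB⁻ _ (range n) k∈)))

  ∈-bList⁺ : ∀ {a} → a ∈ negList t → ∣ val t a ∣ ∈[1, n ] → ∣ val t a ∣ ∈ bList t
  ∈-bList⁺ a∈ ∣ta∣∈[1,n] =
    ∈-filterB⁺ _ (∈-range⁺ n ∣ta∣∈[1,n]) (∈⇒memB _ (∈-map⁺ (λ a → ∣ val t a ∣) a∈))

  Increasing-bList : Increasing (bList t)
  Increasing-bList = AllPairs-filterB _ (Increasing-range n)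

negList-cong : ∀ {n} (t u : Vec ℤ n) → (∀ {i} → i ∈[1, n ] → isNeg (val t i) ≡ isNeg (val u i)) →
               negList t ≡ negList u
negList-cong {n} t u signs = filterB-cong (range n) (signs ∘ ∈-range⁻ n)

module _ {n} {t : Vec ℤ n} (t-perm : IsSignedPerm n t) where
  open IsSignedPerm t-perm

  ∣val∣-∈[1,n] : ∀ {i} → i ∈[1, n ] → ∣ val t i ∣ ∈[1, n ]
  ∣val∣-∈[1,n] (1≤i , i≤n) = inRange _ 1≤i i≤n

  ∣val∣-injective : ∀ {i j} → i ∈[1, n ] → j ∈[1, n ] → ∣ val t i ∣ ≡ ∣ val t j ∣ → i ≡ j
  ∣val∣-injective (1≤i , i≤n) (1≤j , j≤n) = injective _ _ 1≤i i≤n 1≤j j≤n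

  ∣val∣-injectiveOn-negList : InjectiveOn (negList t) (λ i → ∣ val t i ∣)
  ∣val∣-injectiveOn-negList i∈ j∈ = ∣val∣-injective (proj₁ (∈-negList⁻ t i∈)) (proj₁ (∈-negList⁻ t j∈))

  ∣val∣-∈-bList : ∀ {a} → a ∈ negList t → ∣ val t a ∣ ∈ bList t
  ∣val∣-∈-bList a∈ = ∈-bList⁺ t a∈ (∣val∣-∈[1,n] (proj₁ (∈-negList⁻ t a∈)))

  ∑-bList : ∀ (f : ℕ → ℕ) → ∑ (bList t) f ≡ ∑[ a ∈ negList t ] f ∣ val t a ∣
  ∑-bList f = begin
    ∑ (bList t) f                                  ≡⟨ ∑-filterB _ (range n) f ⟩
    ∑[ k ∈ range n ] (f k when memB k (map ∣t∣ N)) ≡⟨ ∑-memB (range n) _ f (Unique-range n) A! A⊆range ⟩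
    ∑ (map ∣t∣ N) f                                ≡⟨ ∑-map ∣t∣ N f ⟩
    ∑[ a ∈ N ] f ∣ val t a ∣                        ∎
    where
    open ≡-Reasoning
    N = negList t
    ∣t∣ : ℕ → ℕ
    ∣t∣ a = ∣ val t a ∣
    A! : Unique (map ∣t∣ N)
    A! = Unique-map ∣t∣ ∣val∣-injectiveOn-negList (Increasing⇒Unique (Increasing-negList t))
    A⊆range : map ∣t∣ N ⊆ range n
    A⊆range k∈ with ∈-map⁻ ∣t∣ k∈
    ... | a , a∈ , refl = ∈-range⁺ n (∣val∣-∈[1,n] (proj₁ (∈-negList⁻ t a∈)))

  length-bList : length (bList t) ≡ length (negList t)
  length-bList = trans (length≡∑1 (bList t)) (trans (∑-bList (λ _ → 1)) (sym (length≡∑1 (negList t))))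

IsSignedPerm-reshuffle : ∀ {n} {t u : Vec ℤ n} → IsSignedPerm n u →
  (∀ {i} → i ∈[1, n ] → isNeg (val u i) ≡ false → val t i ≡ val u i) →
  (∀ {i} → i ∈ negList u → ∃ λ j → j ∈ negList u × ∣ val t i ∣ ≡ ∣ val u j ∣) →
  (∀ {j} → j ∈ negList u → ∃ λ i → i ∈ negList u × ∣ val t i ∣ ≡ ∣ val u j ∣) →
  InjectiveOn (negList u) (λ i → ∣ val t i ∣) →
  IsSignedPerm n t
IsSignedPerm-reshuffle {n} {t} {u} u-perm t≡u into onto t-inj = record
  { inRange = λ i 1≤i i≤n → inRange′ (1≤i , i≤n)
  ; injective = λ i j 1≤i i≤n 1≤j j≤n → injective′ (1≤i , i≤n) (1≤j , j≤n)
  ; surjective = λ k 1≤k k≤n → surjective′ (1≤k , k≤n)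
  }
  where
  Sign : ℕ → Set
  Sign i = i ∈ negList u ⊎ (isNeg (val u i) ≡ false × ∣ val t i ∣ ≡ ∣ val u i ∣)

  sign : ∀ {i} → i ∈[1, n ] → Sign i
  sign {i} i∈[1,n] with isNeg (val u i) in neg
  ... | true = inj₁ (∈-negList⁺ u i∈[1,n] neg)
  ... | false = inj₂ (refl , cong ∣_∣ (t≡u i∈[1,n] neg))

  neg≢pos : ∀ {i j} → i ∈ negList u → j ∈[1, n ] → isNeg (val u j) ≡ false → ∣ val u i ∣ ≢ ∣ val u j ∣
  neg≢pos i∈ j∈[1,n] pos eq with refl ← ∣val∣-injective u-perm (proj₁ (∈-negList⁻ u i∈)) j∈[1,n] eq =
    true≢false (trans (sym (proj₂ (∈-negList⁻ u i∈))) pos)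

  inRange′ : ∀ {i} → i ∈[1, n ] → ∣ val t i ∣ ∈[1, n ]
  inRange′ i∈[1,n] with sign i∈[1,n]
  ... | inj₁ i∈ = let j , j∈ , eq = into i∈ in
                  subst (_∈[1, n ]) (sym eq) (∣val∣-∈[1,n] u-perm (proj₁ (∈-negList⁻ u j∈)))
  ... | inj₂ (_ , eq) = subst (_∈[1, n ]) (sym eq) (∣val∣-∈[1,n] u-perm i∈[1,n])

  injective′ : ∀ {i j} → i ∈[1, n ] → j ∈[1, n ] → ∣ val t i ∣ ≡ ∣ val t j ∣ → i ≡ j
  injective′ i∈[1,n] j∈[1,n] eq with sign i∈[1,n] | sign j∈[1,n]
  ... | inj₁ i∈ | inj₁ j∈ = t-inj i∈ j∈ eq
  ... | inj₁ i∈ | inj₂ (pos , eqj) = let k , k∈ , eqi = into i∈ in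
        ⊥-elim (neg≢pos k∈ j∈[1,n] pos (trans (sym eqi) (trans eq eqj)))
  ... | inj₂ (pos , eqi) | inj₁ j∈ = let k , k∈ , eqj = into j∈ in
        ⊥-elim (neg≢pos k∈ i∈[1,n] pos (trans (sym eqj) (trans (sym eq) eqi)))
  ... | inj₂ (_ , eqi) | inj₂ (_ , eqj) = ∣val∣-injective u-perm i∈[1,n] j∈[1,n] (trans (sym eqi) (trans eq eqj))

  surjective′ : ∀ {k} → k ∈[1, n ] → ∃ λ i → 1 ≤ i × i ≤ n × ∣ val t i ∣ ≡ k
  surjective′ (1≤k , k≤n) with IsSignedPerm.surjective u-perm _ 1≤k k≤n
  ... | j , 1≤j , j≤n , refl with sign (1≤j , j≤n)
  ... | inj₂ (_ , eq) = j , 1≤j , j≤n , eq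
  ... | inj₁ j∈ = let i , i∈ , eq = onto j∈ ; 1≤i , i≤n = proj₁ (∈-negList⁻ u i∈) in i , 1≤i , i≤n , eq

-- ρ on SP(n,r)

ρ⁻¹ : ∀ {n r} → Vec ℤ n → Vec ℕ r → Vec ℤ n
ρ⁻¹ {n} τ σ = tabulate λ (p : Fin n) →
  let i = suc (toℕ p) ; N = negList τ in
  if isNeg (val τ i) then - (ℤ.+ ∣ val τ (nth (pv σ (indexOf i N)) N) ∣) else val τ i

ρ⁻¹-val : ∀ {n r} (τ : Vec ℤ n) (σ : Vec ℕ r) {i} → i ∈[1, n ] →
          val (ρ⁻¹ τ σ) i ≡ (if isNeg (val τ i)
                               then - (ℤ.+ ∣ val τ (nth (pv σ (indexOf i (negList τ))) (negList τ)) ∣)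
                               else val τ i)
ρ⁻¹-val τ σ = atD-tabulate (ℤ.+ 0) (λ i → if isNeg (val τ i)
  then - (ℤ.+ ∣ val τ (nth (pv σ (indexOf i (negList τ))) (negList τ)) ∣) else val τ i)

1∈[1,n] : ∀ {n} (t : Vec ℤ n) → val t 1 ℤ.< ℤ.+ 0 → 1 ∈[1, n ]
1∈[1,n] []ᵥ (+<+ ())
1∈[1,n] (_ ∷ᵥ _) _ = s≤s z≤n , s≤s z≤n

module ρ-on-SP {n r} (ν : Vec ℤ n) (ν∈SP : SP n r ν) where
  private
    ν-perm : IsSignedPerm n ν
    ν-perm = proj₁ ν∈SP

  N B : List ℕ
  N = negList ν
  B = bList ν
  τ : Vec ℤ n
  τ = ρτ ν
  σ : Vec ℕ r
  σ = ρσ r ν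

  pos : ℕ → ℕ
  pos i = indexOf i N

  length-N : length N ≡ r
  length-N = proj₁ (proj₂ ν∈SP)

  length-B : length B ≡ r
  length-B = trans (length-bList ν-perm) length-N

  module _ {q : ℕ} (q∈[1,r] : q ∈[1, r ]) where
    q∈[1,length-N] : q ∈[1, length N ]
    q∈[1,length-N] = subst (λ m → q ∈[1, m ]) (sym length-N) q∈[1,r]

    q∈[1,length-B] : q ∈[1, length B ]
    q∈[1,length-B] = subst (λ m → q ∈[1, m ]) (sym length-B) q∈[1,r]

  ∈[1,length-N] : ∀ {q} → q ∈[1, length N ] → q ∈[1, r ]
  ∈[1,length-N] {q} = subst (λ m → q ∈[1, m ]) length-N

  ∈[1,length-B] : ∀ {q} → q ∈[1, length B ] → q ∈[1, r ]
  ∈[1,length-B] {q} = subst (λ m → q ∈[1, m ]) length-B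

  pos-∈[1,r] : ∀ {i} → i ∈ N → pos i ∈[1, r ]
  pos-∈[1,r] i∈ = ∈[1,length-N] (indexOf-∈[1,length] N i∈)

  pos-nth : ∀ {q} → q ∈[1, r ] → pos (nth q N) ≡ q
  pos-nth q∈ = indexOf-nth N (Increasing⇒Unique (Increasing-negList ν)) (q∈[1,length-N] q∈)

  nth-N : ∀ {q} → q ∈[1, r ] → nth q N ∈ N
  nth-N q∈ = nth-∈ N (q∈[1,length-N] q∈)

  nth-B : ∀ {q} → q ∈[1, r ] → nth q B ∈ B
  nth-B q∈ = nth-∈ B (q∈[1,length-B] q∈)

  indexOf-B : ∀ {k} → k ∈ B → indexOf k B ∈[1, r ]
  indexOf-B k∈ = ∈[1,length-B] (indexOf-∈[1,length] B k∈)

  B-∈[1,n] : ∀ {k} → k ∈ B → k ∈[1, n ]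
  B-∈[1,n] k∈ with ∈-bList⁻ ν k∈
  ... | a , a∈ , refl = ∣val∣-∈[1,n] ν-perm (proj₁ (∈-negList⁻ ν a∈))

  τ-val : ∀ {i} → i ∈[1, n ] → val τ i ≡ (if isNeg (val ν i) then - (ℤ.+ nth (pos i) B) else val ν i)
  τ-val = atD-tabulate (ℤ.+ 0) (λ i → if isNeg (val ν i) then - (ℤ.+ nth (pos i) B) else val ν i)

  τ-neg : ∀ {i} → i ∈ N → val τ i ≡ - (ℤ.+ nth (pos i) B)
  τ-neg i∈ with ∈-negList⁻ ν i∈
  ... | i∈[1,n] , neg rewrite τ-val i∈[1,n] | neg = refl

  τ-nonneg : ∀ {i} → i ∈[1, n ] → isNeg (val ν i) ≡ false → val τ i ≡ val ν i
  τ-nonneg i∈[1,n] nonneg rewrite τ-val i∈[1,n] | nonneg = refl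

  ∣τ∣-neg : ∀ {i} → i ∈ N → ∣ val τ i ∣ ≡ nth (pos i) B
  ∣τ∣-neg i∈ = trans (cong ∣_∣ (τ-neg i∈)) (∣-+∣ _)

  τ-isNeg : ∀ {i} → i ∈[1, n ] → isNeg (val τ i) ≡ isNeg (val ν i)
  τ-isNeg {i} i∈[1,n] with isNeg (val ν i) in neg
  ... | true = let i∈ = ∈-negList⁺ ν i∈[1,n] neg in
               trans (cong isNeg (τ-neg i∈)) (isNeg-negate (proj₁ (B-∈[1,n] (nth-B (pos-∈[1,r] i∈)))))
  ... | false = trans (cong isNeg (τ-nonneg i∈[1,n] neg)) neg

  negList-τ : negList τ ≡ N
  negList-τ = negList-cong τ ν τ-isNeg

  σ-val : ∀ {q} → q ∈[1, r ] → pv σ q ≡ indexOf ∣ val ν (nth q N) ∣ B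
  σ-val = atD-tabulate 0 (λ q → indexOf ∣ val ν (nth q N) ∣ B)

  σ-pos : ∀ {i} → i ∈ N → pv σ (pos i) ≡ indexOf ∣ val ν i ∣ B
  σ-pos i∈ = trans (σ-val (pos-∈[1,r] i∈)) (cong (λ a → indexOf ∣ val ν a ∣ B) (nth-indexOf N i∈))

  τ-perm : IsSignedPerm n τ
  τ-perm = IsSignedPerm-reshuffle ν-perm τ-nonneg into onto injectiveOn
    where
    into : ∀ {i} → i ∈ N → ∃ λ j → j ∈ N × ∣ val τ i ∣ ≡ ∣ val ν j ∣
    into i∈ = let j , j∈ , eq = ∈-bList⁻ ν (nth-B (pos-∈[1,r] i∈)) in j , j∈ , trans (∣τ∣-neg i∈) eq
    onto : ∀ {j} → j ∈ N → ∃ λ i → i ∈ N × ∣ val τ i ∣ ≡ ∣ val ν j ∣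
    onto {j} j∈ = let q∈ = indexOf-B (∣val∣-∈-bList ν-perm j∈) in
      nth (indexOf ∣ val ν j ∣ B) N , nth-N q∈ ,
      trans (∣τ∣-neg (nth-N q∈))
            (trans (cong (λ q → nth q B) (pos-nth q∈)) (nth-indexOf B (∣val∣-∈-bList ν-perm j∈)))
    injectiveOn : InjectiveOn N (λ i → ∣ val τ i ∣)
    injectiveOn {i} {j} i∈ j∈ eq = begin
      i                ≡⟨ nth-indexOf N i∈ ⟨
      nth (pos i) N    ≡⟨ cong (λ q → nth q N) pos-eq ⟩
      nth (pos j) N    ≡⟨ nth-indexOf N j∈ ⟩
      j                ∎
      where
      open ≡-Reasoning
      pos-eq : pos i ≡ pos j
      pos-eq = nth-injective B (Increasing⇒Unique (Increasing-bList ν))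
        (q∈[1,length-B] (pos-∈[1,r] i∈)) (q∈[1,length-B] (pos-∈[1,r] j∈))
        (trans (sym (∣τ∣-neg i∈)) (trans eq (∣τ∣-neg j∈)))

  1∈N : 1 ∈ N
  1∈N = let val1<0 = proj₂ (proj₂ ν∈SP) in ∈-negList⁺ ν (1∈[1,n] ν val1<0) (<0⇒isNeg val1<0)

  τ∈AS : AS n r τ
  τ∈AS = (τ-perm , trans (cong length negList-τ) length-N , τ1<0) , ∣τ∣-increasing
    where
    τ∈N : ∀ {i} → i ∈[1, n ] → val τ i ℤ.< ℤ.+ 0 → i ∈ N
    τ∈N i∈[1,n] τi<0 = ∈-negList⁺ ν i∈[1,n] (trans (sym (τ-isNeg i∈[1,n])) (<0⇒isNeg τi<0))
    τ1<0 : val τ 1 ℤ.< ℤ.+ 0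
    τ1<0 = isNeg⇒<0 (trans (τ-isNeg (1∈[1,n] ν (proj₂ (proj₂ ν∈SP)))) (proj₂ (∈-negList⁻ ν 1∈N)))
    ∣τ∣-increasing : ∀ i j → 1 ≤ i → i < j → j ≤ n → val τ i ℤ.< ℤ.+ 0 → val τ j ℤ.< ℤ.+ 0 →
                     ∣ val τ i ∣ < ∣ val τ j ∣
    ∣τ∣-increasing i j 1≤i i<j j≤n τi<0 τj<0 = subst₂ _<_ (sym (∣τ∣-neg i∈)) (sym (∣τ∣-neg j∈))
        (nth-strictMono B (Increasing-bList ν) (proj₁ (pos-∈[1,r] i∈)) pos-< (proj₂ (q∈[1,length-B] (pos-∈[1,r] j∈))))
      where
      i∈ = τ∈N (1≤i , ≤-trans (<⇒≤ i<j) j≤n) τi<0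
      j∈ = τ∈N (≤-trans 1≤i (<⇒≤ i<j) , j≤n) τj<0
      pos-< : pos i < pos j
      pos-< = <ᵇ-sound (trans (indexOf-<ᵇ N (Increasing-negList ν) i∈ j∈) (<ᵇ-true i<j))

  σ-perm : IsPerm r σ
  σ-perm = record
    { inRange = λ q 1≤q q≤r → subst (_∈[1, r ]) (sym (σ-val (1≤q , q≤r))) (indexOf-B (b∈ (1≤q , q≤r)))
    ; injective = λ q q′ 1≤q q≤r 1≤q′ q′≤r → injective′ (1≤q , q≤r) (1≤q′ , q′≤r)
    ; surjective = λ k 1≤k k≤r → surjective′ (1≤k , k≤r)
    }
    where
    b∈ : ∀ {q} → q ∈[1, r ] → ∣ val ν (nth q N) ∣ ∈ B
    b∈ q∈ = ∣val∣-∈-bList ν-perm (nth-N q∈)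
    injective′ : ∀ {q q′} → q ∈[1, r ] → q′ ∈[1, r ] → pv σ q ≡ pv σ q′ → q ≡ q′
    injective′ {q} {q′} q∈ q′∈ eq = nth-injective N (Increasing⇒Unique (Increasing-negList ν))
      (q∈[1,length-N] q∈) (q∈[1,length-N] q′∈)
      (∣val∣-injectiveOn-negList ν-perm (nth-N q∈) (nth-N q′∈) (begin
        ∣ val ν (nth q N) ∣                     ≡⟨ nth-indexOf B (b∈ q∈) ⟨
        nth (indexOf ∣ val ν (nth q N) ∣ B) B   ≡⟨ cong (λ k → nth k B) (σ-val q∈) ⟨
        nth (pv σ q) B                          ≡⟨ cong (λ k → nth k B) eq ⟩
        nth (pv σ q′) B                         ≡⟨ cong (λ k → nth k B) (σ-val q′∈) ⟩
        nth (indexOf ∣ val ν (nth q′ N) ∣ B) B  ≡⟨ nth-indexOf B (b∈ q′∈) ⟩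
        ∣ val ν (nth q′ N) ∣                    ∎))
      where open ≡-Reasoning
    surjective′ : ∀ {k} → k ∈[1, r ] → ∃ λ q → 1 ≤ q × q ≤ r × pv σ q ≡ k
    surjective′ {k} k∈ with ∈-bList⁻ ν (nth-B k∈)
    ... | a , a∈ , eq = pos a , proj₁ (pos-∈[1,r] a∈) , proj₂ (pos-∈[1,r] a∈) ,
          trans (σ-pos a∈) (trans (cong (λ b → indexOf b B) (sym eq))
                                  (indexOf-nth B (Increasing⇒Unique (Increasing-bList ν)) (q∈[1,length-B] k∈)))

  ρ⁻¹-ρ : ρ⁻¹ τ σ ≡ ν
  ρ⁻¹-ρ = atD-ext (ℤ.+ 0) (ρ⁻¹ τ σ) ν pointwise
    where
    pointwise : ∀ {i} → i ∈[1, n ] → val (ρ⁻¹ τ σ) i ≡ val ν i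
    pointwise {i} i∈[1,n] rewrite ρ⁻¹-val τ σ i∈[1,n] | τ-isNeg i∈[1,n] | negList-τ
      with isNeg (val ν i) in neg
    ... | false = τ-nonneg i∈[1,n] neg
    ... | true = begin
      - (ℤ.+ ∣ val τ (nth (pv σ (pos i)) N) ∣)   ≡⟨ cong (λ q → - (ℤ.+ ∣ val τ (nth q N) ∣)) (σ-pos i∈) ⟩
      - (ℤ.+ ∣ val τ (nth q N) ∣)                ≡⟨ cong (λ k → - (ℤ.+ k)) (∣τ∣-neg (nth-N q∈)) ⟩
      - (ℤ.+ nth (pos (nth q N)) B)              ≡⟨ cong (λ p → - (ℤ.+ nth p B)) (pos-nth q∈) ⟩
      - (ℤ.+ nth q B)                            ≡⟨ cong (λ k → - (ℤ.+ k)) (nth-indexOf B ∣νi∣∈B) ⟩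
      - (ℤ.+ ∣ val ν i ∣)                        ≡⟨ isNeg⇒≡-∣∣ neg ⟩
      val ν i                                    ∎
      where
      open ≡-Reasoning
      i∈ = ∈-negList⁺ ν i∈[1,n] neg
      ∣νi∣∈B = ∣val∣-∈-bList ν-perm i∈
      q = indexOf ∣ val ν i ∣ B
      q∈ = indexOf-B ∣νi∣∈B

module ρ⁻¹-on-AS {n r} (τ : Vec ℤ n) (τ∈AS : AS n r τ) (σ : Vec ℕ r) (σ-perm : IsPerm r σ) where
  open ρ-on-SP τ (proj₁ τ∈AS) using (N; pos; pos-∈[1,r]; pos-nth; nth-N; length-N; q∈[1,length-N]; 1∈N)
  open IsPerm σ-perm

  private
    τ-perm : IsSignedPerm n τ
    τ-perm = proj₁ (proj₁ τ∈AS)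

  ν : Vec ℤ n
  ν = ρ⁻¹ τ σ

  partner : ℕ → ℕ
  partner i = nth (pv σ (pos i)) N

  σ-∈[1,r] : ∀ {q} → q ∈[1, r ] → pv σ q ∈[1, r ]
  σ-∈[1,r] (1≤q , q≤r) = inRange _ 1≤q q≤r

  partner-∈ : ∀ {i} → i ∈ N → partner i ∈ N
  partner-∈ i∈ = nth-N (σ-∈[1,r] (pos-∈[1,r] i∈))

  partner-injective : InjectiveOn N partner
  partner-injective {i} {j} i∈ j∈ eq = begin
    i              ≡⟨ nth-indexOf N i∈ ⟨
    nth (pos i) N  ≡⟨ cong (λ q → nth q N) pos-eq ⟩
    nth (pos j) N  ≡⟨ nth-indexOf N j∈ ⟩
    j              ∎
    where
    open ≡-Reasoning
    pos-eq : pos i ≡ pos j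
    pos-eq = let 1≤i , i≤r = pos-∈[1,r] i∈ ; 1≤j , j≤r = pos-∈[1,r] j∈ in
      injective _ _ 1≤i i≤r 1≤j j≤r (nth-injective N (Increasing⇒Unique (Increasing-negList τ))
        (q∈[1,length-N] (σ-∈[1,r] (pos-∈[1,r] i∈))) (q∈[1,length-N] (σ-∈[1,r] (pos-∈[1,r] j∈))) eq)

  partner-surjective : ∀ {j} → j ∈ N → ∃ λ i → i ∈ N × partner i ≡ j
  partner-surjective {j} j∈ =
    let 1≤p , p≤r = pos-∈[1,r] j∈ ; q , 1≤q , q≤r , σq≡ = surjective (pos j) 1≤p p≤r in
    nth q N , nth-N (1≤q , q≤r) ,
    trans (cong (λ p → nth (pv σ p) N) (pos-nth (1≤q , q≤r))) (trans (cong (λ p → nth p N) σq≡) (nth-indexOf N j∈))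

  ν-neg : ∀ {i} → i ∈ N → val ν i ≡ - (ℤ.+ ∣ val τ (partner i) ∣)
  ν-neg i∈ with ∈-negList⁻ τ i∈
  ... | i∈[1,n] , neg rewrite ρ⁻¹-val τ σ i∈[1,n] | neg = refl

  ν-nonneg : ∀ {i} → i ∈[1, n ] → isNeg (val τ i) ≡ false → val ν i ≡ val τ i
  ν-nonneg i∈[1,n] nonneg rewrite ρ⁻¹-val τ σ i∈[1,n] | nonneg = refl

  ∣ν∣-neg : ∀ {i} → i ∈ N → ∣ val ν i ∣ ≡ ∣ val τ (partner i) ∣
  ∣ν∣-neg i∈ = trans (cong ∣_∣ (ν-neg i∈)) (∣-+∣ _)

  ν-isNeg : ∀ {i} → i ∈[1, n ] → isNeg (val ν i) ≡ isNeg (val τ i)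
  ν-isNeg {i} i∈[1,n] with isNeg (val τ i) in neg
  ... | true = let p∈ = partner-∈ (∈-negList⁺ τ i∈[1,n] neg) in
               trans (cong isNeg (ν-neg (∈-negList⁺ τ i∈[1,n] neg)))
                     (isNeg-negate (proj₁ (∣val∣-∈[1,n] τ-perm (proj₁ (∈-negList⁻ τ p∈)))))
  ... | false = trans (cong isNeg (ν-nonneg i∈[1,n] neg)) neg

  negList-ν : negList ν ≡ N
  negList-ν = negList-cong ν τ ν-isNeg

  ν-perm : IsSignedPerm n ν
  ν-perm = IsSignedPerm-reshuffle τ-perm ν-nonneg
    (λ i∈ → partner _ , partner-∈ i∈ , ∣ν∣-neg i∈)
    (λ j∈ → let i , i∈ , eq = partner-surjective j∈ in
            i , i∈ , trans (∣ν∣-neg i∈) (cong (λ a → ∣ val τ a ∣) eq))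
    (λ i∈ j∈ eq → partner-injective i∈ j∈
      (∣val∣-injectiveOn-negList τ-perm (partner-∈ i∈) (partner-∈ j∈)
        (trans (sym (∣ν∣-neg i∈)) (trans eq (∣ν∣-neg j∈)))))

  ν∈SP : SP n r ν
  ν∈SP = ν-perm , trans (cong length negList-ν) length-N ,
         isNeg⇒<0 (trans (ν-isNeg (proj₁ (∈-negList⁻ τ 1∈N))) (proj₂ (∈-negList⁻ τ 1∈N)))

  M : List ℕ
  M = map (λ a → ∣ val τ a ∣) N

  Increasing-M : Increasing M
  Increasing-M = Increasing-map (λ a → ∣ val τ a ∣) ∣τ∣-increasing (Increasing-negList τ)
    where
    ∣τ∣-increasing : ∀ {i j} → i ∈ N → j ∈ N → i < j → ∣ val τ i ∣ < ∣ val τ j ∣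
    ∣τ∣-increasing i∈ j∈ i<j = let (1≤i , _) , negi = ∈-negList⁻ τ i∈ ; (_ , j≤n) , negj = ∈-negList⁻ τ j∈ in
      proj₂ τ∈AS _ _ 1≤i i<j j≤n (isNeg⇒<0 negi) (isNeg⇒<0 negj)

  bList-ν : bList ν ≡ M
  bList-ν = Increasing-⊆-antisym (Increasing-bList ν) Increasing-M B⊆M M⊆B
    where
    B⊆M : bList ν ⊆ M
    B⊆M k∈ with ∈-bList⁻ ν k∈
    ... | a , a∈ , refl = let a∈N = subst (a ∈_) negList-ν a∈ in
      subst (_∈ M) (sym (∣ν∣-neg a∈N)) (∈-map⁺ (λ a → ∣ val τ a ∣) (partner-∈ a∈N))
    M⊆B : M ⊆ bList ν
    M⊆B k∈ with ∈-map⁻ (λ a → ∣ val τ a ∣) k∈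
    ... | b , b∈ , refl = let a , a∈ , eq = partner-surjective b∈ in
      subst (_∈ bList ν) (trans (∣ν∣-neg a∈) (cong (λ c → ∣ val τ c ∣) eq))
            (∣val∣-∈-bList ν-perm (subst (a ∈_) (sym negList-ν) a∈))

  private
    module V = ρ-on-SP ν ν∈SP

  ρτ-ν : ρτ ν ≡ τ
  ρτ-ν = atD-ext (ℤ.+ 0) (ρτ ν) τ pointwise
    where
    pointwise : ∀ {i} → i ∈[1, n ] → val (ρτ ν) i ≡ val τ i
    pointwise {i} i∈[1,n] with isNeg (val τ i) in neg
    ... | false = trans (V.τ-nonneg i∈[1,n] (trans (ν-isNeg i∈[1,n]) neg)) (ν-nonneg i∈[1,n] neg)
    ... | true = begin
      val (ρτ ν) i
        ≡⟨ V.τ-neg (subst (i ∈_) (sym negList-ν) i∈) ⟩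
      - (ℤ.+ nth (indexOf i (negList ν)) (bList ν))
        ≡⟨ cong₂ (λ L K → - (ℤ.+ nth (indexOf i L) K)) negList-ν bList-ν ⟩
      - (ℤ.+ nth (pos i) M)
        ≡⟨ cong (λ k → - (ℤ.+ k)) (nth-map _ N (q∈[1,length-N] (pos-∈[1,r] i∈))) ⟩
      - (ℤ.+ ∣ val τ (nth (pos i) N) ∣)
        ≡⟨ cong (λ a → - (ℤ.+ ∣ val τ a ∣)) (nth-indexOf N i∈) ⟩
      - (ℤ.+ ∣ val τ i ∣)
        ≡⟨ isNeg⇒≡-∣∣ neg ⟩
      val τ i ∎
      where
      open ≡-Reasoning
      i∈ = ∈-negList⁺ τ i∈[1,n] neg

  ρσ-ν : ρσ r ν ≡ σ
  ρσ-ν = atD-ext 0 (ρσ r ν) σ pointwise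
    where
    pointwise : ∀ {q} → q ∈[1, r ] → pv (ρσ r ν) q ≡ pv σ q
    pointwise {q} q∈ = begin
      pv (ρσ r ν) q
        ≡⟨ V.σ-val q∈ ⟩
      indexOf (∣ val ν (nth q (negList ν)) ∣) (bList ν)
        ≡⟨ cong₂ (λ L K → indexOf ∣ val ν (nth q L) ∣ K) negList-ν bList-ν ⟩
      indexOf (∣ val ν (nth q N) ∣) M
        ≡⟨ cong (λ k → indexOf k M) (∣ν∣-neg (nth-N q∈)) ⟩
      indexOf (∣ val τ (nth (pv σ (pos (nth q N))) N) ∣) M
        ≡⟨ cong (λ p → indexOf ∣ val τ (nth (pv σ p) N) ∣ M) (pos-nth q∈) ⟩
      indexOf (∣ val τ (nth (pv σ q) N) ∣) M
        ≡⟨ cong (λ k → indexOf k M) (nth-map _ N (q∈[1,length-N] σq∈)) ⟨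
      indexOf (nth (pv σ q) M) M
        ≡⟨ indexOf-nth M (Increasing⇒Unique Increasing-M) σq∈[1,length-M] ⟩
      pv σ q ∎
      where
      open ≡-Reasoning
      σq∈ = σ-∈[1,r] q∈
      σq∈[1,length-M] : pv σ q ∈[1, length M ]
      σq∈[1,length-M] = subst (λ m → pv σ q ∈[1, m ]) (sym (trans (length-map _ N) length-N)) σq∈

  ρ-ν : ρ n r ν ≡ (τ , σ)
  ρ-ν = cong₂ _,_ ρτ-ν ρσ-ν

-- The order <_τ and the ranks

lex : ℕ → Bool → ℕ
lex a f = a + a + 𝟙 f

𝟙≤1 : ∀ f → 𝟙 f ≤ 1
𝟙≤1 true = ≤-refl
𝟙≤1 false = z≤n

lex-<⁺ : ∀ {a b} f g → a < b → lex a f < lex b g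
lex-<⁺ {a} {b} f g a<b = begin-strict
  a + a + 𝟙 f          ≤⟨ +-monoʳ-≤ (a + a) (𝟙≤1 f) ⟩
  a + a + 1            ≡⟨ +-comm (a + a) 1 ⟩
  suc (a + a)          <⟨ n<1+n _ ⟩
  suc (suc (a + a))    ≡⟨ cong suc (+-suc a a) ⟨
  suc a + suc a        ≤⟨ +-mono-≤ a<b a<b ⟩
  b + b                ≤⟨ m≤m+n (b + b) (𝟙 g) ⟩
  b + b + 𝟙 g          ∎
  where open ≤-Reasoning

lex-false<true : ∀ a → lex a false < lex a true
lex-false<true a = +-monoʳ-< (a + a) z<s

lex-<⁻ : ∀ {a b} f g → lex a f < lex b g → a < b ⊎ (a ≡ b × f ≡ false × g ≡ true)
lex-<⁻ {a} {b} f g lt with <-cmp a b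
... | tri< a<b _ _ = inj₁ a<b
... | tri> _ _ b<a = ⊥-elim (<-asym lt (lex-<⁺ g f b<a))
lex-<⁻ false true _ | tri≈ _ refl _ = inj₂ (refl , refl , refl)
lex-<⁻ false false lt | tri≈ _ refl _ = ⊥-elim (<-irrefl refl lt)
lex-<⁻ true true lt | tri≈ _ refl _ = ⊥-elim (<-irrefl refl lt)
lex-<⁻ {a} true false lt | tri≈ _ refl _ = ⊥-elim (<-asym lt (lex-false<true a))

lex-injective : ∀ {a b} f g → lex a f ≡ lex b g → a ≡ b × f ≡ g
lex-injective {a} {b} f g eq with <-cmp a b
... | tri< a<b _ _ = ⊥-elim (<-irrefl eq (lex-<⁺ f g a<b))
... | tri> _ _ b<a = ⊥-elim (<-irrefl (sym eq) (lex-<⁺ g f b<a))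
lex-injective false false _ | tri≈ _ refl _ = refl , refl
lex-injective true true _ | tri≈ _ refl _ = refl , refl
lex-injective {a} false true eq | tri≈ _ refl _ = ⊥-elim (<-irrefl eq (lex-false<true a))
lex-injective {a} true false eq | tri≈ _ refl _ = ⊥-elim (<-irrefl (sym eq) (lex-false<true a))

module Order {n} {t : Vec ℤ n} (t-perm : IsSignedPerm n t) where

  below : ℕ → Bool
  below i = not (i ≤ᵇ ∣ val t i ∣)

  -- <_t is the lexicographic order on (key t i , below i): on a tie of keys, the point whose key is
  -- its own position comes first.
  K : ℕ → ℕ
  K i = lex (key t i) (below i)

  key≡pos : ∀ {i} → below i ≡ false → key t i ≡ i
  key≡pos {i} not-below with i ≤ᵇ ∣ val t i ∣ in i≤
  ... | true = m≤n⇒m⊓n≡m (≤ᵇ-sound i≤)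

  key≡∣val∣ : ∀ {i} → below i ≡ true → key t i ≡ ∣ val t i ∣
  key≡∣val∣ {i} is-below with i ≤ᵇ ∣ val t i ∣ in i≤
  ... | false = m≥n⇒m⊓n≡n (≰⇒≥ (λ i≤∣ti∣ → true≢false (trans (sym (≤ᵇ-true i≤∣ti∣)) i≤)))

  key≡pos⇒not-below : ∀ {i} → key t i ≡ i → below i ≡ false
  key≡pos⇒not-below {i} eq rewrite ≤ᵇ-true (m⊓n≡m⇒m≤n {i} {∣ val t i ∣} eq) = refl

  key≡∣val∣⇒below : ∀ {i} → key t i ≡ ∣ val t i ∣ → ∣ val t i ∣ ≢ i → below i ≡ true
  key≡∣val∣⇒below {i} eq ∣ti∣≢i with i ≤ᵇ ∣ val t i ∣ in i≤
  ... | false = refl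
  ... | true = ⊥-elim (∣ti∣≢i (≤-antisym (m⊓n≡n⇒n≤m {i} eq) (≤ᵇ-sound i≤)))

  ltτ≡K<K : ∀ {k i} → k ≢ i → ltτ t k i ≡ (K k <ᵇ K i)
  ltτ≡K<K {k} {i} k≢i = ⇔-≡ to from
    where
    to : ltτ t k i ≡ true → (K k <ᵇ K i) ≡ true
    to lt with key t k <ᵇ key t i in key<
    ... | true = <ᵇ-true {K k} {K i} (lex-<⁺ {key t k} {key t i} (below k) (below i) (<ᵇ-sound key<))
    ... | false = <ᵇ-true {K k} {K i} (begin-strict
      K k                  ≡⟨ cong (lex (key t k)) (key≡pos⇒not-below keyk≡k) ⟩
      lex (key t k) false  ≡⟨ cong (λ a → lex a false) keys≡ ⟩
      lex (key t i) false  <⟨ lex-false<true (key t i) ⟩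
      lex (key t i) true   ≡⟨ cong (lex (key t i)) (key≡∣val∣⇒below (sym ∣ti∣≡keyi) ∣ti∣≢i) ⟨
      K i                  ∎)
      where
      open ≤-Reasoning
      tie = ∧-conicalʳ (key t k ≡ᵇ k) _ lt
      keyk≡k = ≡ᵇ-sound (∧-conicalˡ (key t k ≡ᵇ k) _ lt)
      k≡∣ti∣ = ≡ᵇ-sound (∧-conicalˡ (k ≡ᵇ ∣ val t i ∣) _ tie)
      ∣ti∣≡keyi = ≡ᵇ-sound (∧-conicalʳ (k ≡ᵇ ∣ val t i ∣) _ tie)
      keys≡ : key t k ≡ key t i
      keys≡ = trans keyk≡k (trans k≡∣ti∣ ∣ti∣≡keyi)
      ∣ti∣≢i : ∣ val t i ∣ ≢ i
      ∣ti∣≢i eq = k≢i (trans k≡∣ti∣ eq)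
    from : (K k <ᵇ K i) ≡ true → ltτ t k i ≡ true
    from lt with lex-<⁻ {key t k} {key t i} (below k) (below i) (<ᵇ-sound lt)
    ... | inj₁ key< rewrite <ᵇ-true {key t k} {key t i} key< = refl
    ... | inj₂ (keys≡ , not-below , is-below)
      rewrite <ᵇ-false {key t k} (≤-reflexive (sym keys≡)) | ≡ᵇ-true {key t k} (key≡pos not-below)
            | ≡ᵇ-true {k} (trans (sym (key≡pos not-below)) (trans keys≡ (key≡∣val∣ is-below)))
            | ≡ᵇ-true {∣ val t i ∣} (sym (key≡∣val∣ is-below)) = refl

  K-injective : ∀ {i j} → i ∈[1, n ] → j ∈[1, n ] → K i ≡ K j → i ≡ j
  K-injective {i} {j} i∈ j∈ eq = by-below (below i) refl (lex-injective (below i) (below j) eq)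
    where
    by-below : ∀ b → below i ≡ b → key t i ≡ key t j × below i ≡ below j → i ≡ j
    by-below false bi (keys≡ , belows≡) =
      trans (sym (key≡pos bi)) (trans keys≡ (key≡pos (trans (sym belows≡) bi)))
    by-below true bi (keys≡ , belows≡) = ∣val∣-injective t-perm i∈ j∈
      (trans (sym (key≡∣val∣ bi)) (trans keys≡ (key≡∣val∣ (trans (sym belows≡) bi))))

  K-mono : ∀ {i j} → key t i < key t j → K i < K j
  K-mono {i} {j} = lex-<⁺ {key t i} {key t j} (below i) (below j)

  rank≡ : ∀ i → rank t i ≡ suc (∑[ k ∈ negList t ] 𝟙 (K k <ᵇ K i))
  rank≡ i = cong suc (trans (count≡∑ _ (negList t)) (∑-cong (negList t) (λ {k} _ → cong 𝟙 (before k))))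
    where
    before : ∀ k → not (k ≡ᵇ i) ∧ ltτ t k i ≡ (K k <ᵇ K i)
    before k with k ≟ i
    ... | yes refl rewrite ≡ᵇ-true {k} refl = sym (<ᵇ-irrefl (K k))
    ... | no k≢i rewrite ≡ᵇ-false k≢i = ltτ≡K<K k≢i

  rank-mono-≤ : ∀ {i j} → K i ≤ K j → rank t i ≤ rank t j
  rank-mono-≤ {i} {j} Ki≤Kj = subst₂ _≤_ (sym (rank≡ i)) (sym (rank≡ j))
    (s≤s (∑-mono-≤ (negList t) (λ _ → 𝟙-mono (λ Kk<Ki → <ᵇ-true (<-≤-trans (<ᵇ-sound Kk<Ki) Ki≤Kj)))))

  rank-mono-< : ∀ {i j} → i ∈ negList t → K i < K j → rank t i < rank t j
  rank-mono-< {i} {j} i∈ Ki<Kj = subst₂ _<_ (sym (rank≡ i)) (sym (rank≡ j))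
    (s<s (∑-mono-< (negList t) (λ _ → 𝟙-mono (λ Kk<Ki → <ᵇ-true (<-trans (<ᵇ-sound Kk<Ki) Ki<Kj))) i∈ at-i))
    where
    at-i : 𝟙 (K i <ᵇ K i) < 𝟙 (K i <ᵇ K j)
    at-i rewrite <ᵇ-irrefl (K i) | <ᵇ-true Ki<Kj = z<s

  rank-<ᵇ : ∀ {i j} → j ∈ negList t → (rank t j <ᵇ rank t i) ≡ (K j <ᵇ K i)
  rank-<ᵇ {i} {j} j∈ with <-≤-connex (K j) (K i)
  ... | inj₁ Kj<Ki = trans (<ᵇ-true (rank-mono-< j∈ Kj<Ki)) (sym (<ᵇ-true Kj<Ki))
  ... | inj₂ Ki≤Kj = trans (<ᵇ-false (rank-mono-≤ Ki≤Kj)) (sym (<ᵇ-false Ki≤Kj))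

-- Arcs and crossings

upperArc⁺ : ℕ → ℤ → List (ℤ × ℤ)
upperArc⁺ i x = if (ℤ.+ i) ℤ.≤ᵇ x then (ℤ.+ i , x) ∷ [] else []

lowerArc⁺ : ℕ → ℤ → List (ℤ × ℤ)
lowerArc⁺ i x = if ((ℤ.+ 0) <ᶻ x) ∧ (x <ᶻ (ℤ.+ i)) then (x , ℤ.+ i) ∷ [] else []

upperArcsAt : ∀ {n} → Vec ℤ n → ℕ → List (ℤ × ℤ)
upperArcsAt t i = if isNeg (val t i) then (- (ℤ.+ rank t i) , ℤ.+ ∣ val t i ∣) ∷ [] else upperArc⁺ i (val t i)

lowerArcsAt : ∀ {n} → Vec ℤ n → ℕ → List (ℤ × ℤ)
lowerArcsAt t i = if isNeg (val t i) then (- (ℤ.+ rank t i) , ℤ.+ i) ∷ [] else lowerArc⁺ i (val t i)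

upperCrossings lowerCrossings : List (ℤ × ℤ) → List (ℤ × ℤ) → ℕ
upperCrossings xs ys = ∑[ a ∈ xs ] ∑[ b ∈ ys ] 𝟙 (upperCross (a , b))
lowerCrossings xs ys = ∑[ a ∈ xs ] ∑[ b ∈ ys ] 𝟙 (lowerCross (a , b))

crossings : ∀ {n} → Vec ℤ n → ℕ → ℕ → ℕ
crossings t i j = upperCrossings (upperArcsAt t i) (upperArcsAt t j) + lowerCrossings (lowerArcsAt t i) (lowerArcsAt t j)

count-pairs-concatMap : ∀ {X : Set} (g : ℕ → List X) (p : X × X → Bool) (xs : List ℕ) →
  count p (cartesianProduct (concatMap g xs) (concatMap g xs)) ≡
  ∑[ i ∈ xs ] ∑[ j ∈ xs ] ∑[ a ∈ g i ] ∑[ b ∈ g j ] 𝟙 (p (a , b))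
count-pairs-concatMap g p xs = begin
  count p (cartesianProduct (concatMap g xs) (concatMap g xs))
    ≡⟨ count≡∑ p (cartesianProduct (concatMap g xs) (concatMap g xs)) ⟩
  ∑[ ab ∈ cartesianProduct (concatMap g xs) (concatMap g xs) ] 𝟙 (p ab)
    ≡⟨ ∑-cartesianProduct (concatMap g xs) (concatMap g xs) (𝟙 ∘ p) ⟩
  ∑[ a ∈ concatMap g xs ] ∑[ b ∈ concatMap g xs ] 𝟙 (p (a , b))
    ≡⟨ ∑-concatMap g xs _ ⟩
  ∑[ i ∈ xs ] ∑[ a ∈ g i ] ∑[ b ∈ concatMap g xs ] 𝟙 (p (a , b))
    ≡⟨ ∑-cong xs (λ {i} _ → ∑-cong (g i) (λ {a} _ → ∑-concatMap g xs (λ b → 𝟙 (p (a , b))))) ⟩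
  ∑[ i ∈ xs ] ∑[ a ∈ g i ] ∑[ j ∈ xs ] ∑[ b ∈ g j ] 𝟙 (p (a , b))
    ≡⟨ ∑-cong xs (λ {i} _ → ∑-comm (g i) xs _) ⟩
  ∑[ i ∈ xs ] ∑[ j ∈ xs ] ∑[ a ∈ g i ] ∑[ b ∈ g j ] 𝟙 (p (a , b)) ∎
  where open ≡-Reasoning

cro≡∑crossings : ∀ {n} (t : Vec ℤ n) → cro t ≡ ∑[ i ∈ range n ] ∑[ j ∈ range n ] crossings t i j
cro≡∑crossings {n} t =
  trans (cong₂ _+_ (count-pairs-concatMap (upperArcsAt t) upperCross (range n))
                   (count-pairs-concatMap (lowerArcsAt t) lowerCross (range n)))
        (sym (∑∑-distrib-+ (range n) _ _))

-- The crossings between the arcs of a negative point and those of a nonnegative point j ↦ x do not depend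
-- on the common left end -c of the negative point's arcs, which lies left of every other endpoint.
upper⁻⁺ : ℕ → ℕ → ℤ → ℕ
upper⁻⁺ b j x = upperCrossings ((-[1+ 0 ] , ℤ.+ b) ∷ []) (upperArc⁺ j x)

lower⁻⁺ : ℕ → ℕ → ℤ → ℕ
lower⁻⁺ i j x = lowerCrossings ((-[1+ 0 ] , ℤ.+ i) ∷ []) (lowerArc⁺ j x)

crossings⁺⁺ : ℕ → ℤ → ℕ → ℤ → ℕ
crossings⁺⁺ i x j y = upperCrossings (upperArc⁺ i x) (upperArc⁺ j y) + lowerCrossings (lowerArc⁺ i x) (lowerArc⁺ j y)

upperCrossings⁻⁺ : ∀ {c} b j x → upperCrossings ((-[1+ c ] , ℤ.+ b) ∷ []) (upperArc⁺ j x) ≡ upper⁻⁺ b j x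
upperCrossings⁻⁺ b j x with (ℤ.+ j) ℤ.≤ᵇ x
... | true = refl
... | false = refl

lowerCrossings⁻⁺ : ∀ {c} i j x → isNeg x ≡ false →
                   lowerCrossings ((-[1+ c ] , ℤ.+ i) ∷ []) (lowerArc⁺ j x) ≡ lower⁻⁺ i j x
lowerCrossings⁻⁺ i j (ℤ.+ m) _ with ((ℤ.+ 0) <ᶻ (ℤ.+ m)) ∧ ((ℤ.+ m) <ᶻ (ℤ.+ j))
... | true = refl
... | false = refl

upperCrossings⁺⁻ : ∀ {c} i x b → upperCrossings (upperArc⁺ i x) ((-[1+ c ] , b) ∷ []) ≡ 0
upperCrossings⁺⁻ i x b with (ℤ.+ i) ℤ.≤ᵇ x
... | true = refl
... | false = refl

lowerCrossings⁺⁻ : ∀ {c} i x b → isNeg x ≡ false → lowerCrossings (lowerArc⁺ i x) ((-[1+ c ] , b) ∷ []) ≡ 0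
lowerCrossings⁺⁻ i (ℤ.+ m) b _ with ((ℤ.+ 0) <ᶻ (ℤ.+ m)) ∧ ((ℤ.+ m) <ᶻ (ℤ.+ i))
... | true = refl
... | false = refl

upperCrossings⁻⁻ : ∀ {ci cj} bi bj →
  upperCrossings ((-[1+ ci ] , ℤ.+ bi) ∷ []) ((-[1+ cj ] , ℤ.+ bj) ∷ []) ≡ 𝟙 ((cj <ᵇ ci) ∧ (bi <ᵇ bj))
upperCrossings⁻⁻ {ci} {cj} bi bj =
  trans (+-identityʳ _) (trans (+-identityʳ _) (cong 𝟙 (cong₂ _∧_ (not-≤ᵇ ci cj) (not-≤ᵇ bj bi))))

lowerCrossings⁻⁻ : ∀ {ci cj} i j →
  lowerCrossings ((-[1+ ci ] , ℤ.+ i) ∷ []) ((-[1+ cj ] , ℤ.+ j) ∷ []) ≡ 𝟙 ((cj <ᵇ ci) ∧ (i <ᵇ j))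
lowerCrossings⁻⁻ {ci} {cj} i j =
  trans (+-identityʳ _) (trans (+-identityʳ _) (cong 𝟙 (cong₂ _∧_ (not-≤ᵇ ci cj) (not-≤ᵇ j i))))

module _ {n} (t : Vec ℤ n) where

  upperArcsAt-neg : ∀ {i} → isNeg (val t i) ≡ true → upperArcsAt t i ≡ (- (ℤ.+ rank t i) , ℤ.+ ∣ val t i ∣) ∷ []
  upperArcsAt-neg {i} neg =
    cong (λ b → if b then (- (ℤ.+ rank t i) , ℤ.+ ∣ val t i ∣) ∷ [] else upperArc⁺ i (val t i)) neg

  upperArcsAt-nonneg : ∀ {i} → isNeg (val t i) ≡ false → upperArcsAt t i ≡ upperArc⁺ i (val t i)
  upperArcsAt-nonneg {i} nonneg =
    cong (λ b → if b then (- (ℤ.+ rank t i) , ℤ.+ ∣ val t i ∣) ∷ [] else upperArc⁺ i (val t i)) nonneg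

  lowerArcsAt-neg : ∀ {i} → isNeg (val t i) ≡ true → lowerArcsAt t i ≡ (- (ℤ.+ rank t i) , ℤ.+ i) ∷ []
  lowerArcsAt-neg {i} neg =
    cong (λ b → if b then (- (ℤ.+ rank t i) , ℤ.+ i) ∷ [] else lowerArc⁺ i (val t i)) neg

  lowerArcsAt-nonneg : ∀ {i} → isNeg (val t i) ≡ false → lowerArcsAt t i ≡ lowerArc⁺ i (val t i)
  lowerArcsAt-nonneg {i} nonneg =
    cong (λ b → if b then (- (ℤ.+ rank t i) , ℤ.+ i) ∷ [] else lowerArc⁺ i (val t i)) nonneg

  module _ {i j : ℕ} where

    crossings⁻⁻ : isNeg (val t i) ≡ true → isNeg (val t j) ≡ true →
      crossings t i j ≡ 𝟙 ((rank t j <ᵇ rank t i) ∧ (∣ val t i ∣ <ᵇ ∣ val t j ∣))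
                      + 𝟙 ((rank t j <ᵇ rank t i) ∧ (i <ᵇ j))
    crossings⁻⁻ negi negj = cong₂ _+_
      (trans (cong₂ upperCrossings (upperArcsAt-neg negi) (upperArcsAt-neg negj))
             (upperCrossings⁻⁻ {pred (rank t i)} {pred (rank t j)} ∣ val t i ∣ ∣ val t j ∣))
      (trans (cong₂ lowerCrossings (lowerArcsAt-neg negi) (lowerArcsAt-neg negj))
             (lowerCrossings⁻⁻ {pred (rank t i)} {pred (rank t j)} i j))

    crossings⁺⁻ : isNeg (val t i) ≡ false → isNeg (val t j) ≡ true → crossings t i j ≡ 0
    crossings⁺⁻ nonnegi negj = cong₂ _+_
      (trans (cong₂ upperCrossings (upperArcsAt-nonneg nonnegi) (upperArcsAt-neg negj))
             (upperCrossings⁺⁻ i (val t i) (ℤ.+ ∣ val t j ∣)))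
      (trans (cong₂ lowerCrossings (lowerArcsAt-nonneg nonnegi) (lowerArcsAt-neg negj))
             (lowerCrossings⁺⁻ i (val t i) (ℤ.+ j) nonnegi))

    crossings⁻⁺ : isNeg (val t i) ≡ true → isNeg (val t j) ≡ false →
      crossings t i j ≡ upper⁻⁺ ∣ val t i ∣ j (val t j) + lower⁻⁺ i j (val t j)
    crossings⁻⁺ negi nonnegj = cong₂ _+_
      (trans (cong₂ upperCrossings (upperArcsAt-neg negi) (upperArcsAt-nonneg nonnegj))
             (upperCrossings⁻⁺ ∣ val t i ∣ j (val t j)))
      (trans (cong₂ lowerCrossings (lowerArcsAt-neg negi) (lowerArcsAt-nonneg nonnegj))
             (lowerCrossings⁻⁺ i j (val t j) nonnegj))

    crossings⁺⁺-at : isNeg (val t i) ≡ false → isNeg (val t j) ≡ false →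
      crossings t i j ≡ crossings⁺⁺ i (val t i) j (val t j)
    crossings⁺⁺-at nonnegi nonnegj = cong₂ _+_
      (cong₂ upperCrossings (upperArcsAt-nonneg nonnegi) (upperArcsAt-nonneg nonnegj))
      (cong₂ lowerCrossings (lowerArcsAt-nonneg nonnegi) (lowerArcsAt-nonneg nonnegj))

nonnegPart : ∀ {n} → Vec ℤ n → ℕ → Maybe ℤ
nonnegPart t k = if isNeg (val t k) then nothing else just (val t k)

fixedCrossingsBy : ℕ → Maybe ℤ → ℕ → Maybe ℤ → ℕ
fixedCrossingsBy i _ j nothing = 0
fixedCrossingsBy i nothing j (just y) = lower⁻⁺ i j y
fixedCrossingsBy i (just x) j (just y) = crossings⁺⁺ i x j y

upperHitBy : ℕ → ℕ → Maybe ℤ → ℕ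
upperHitBy b j nothing = 0
upperHitBy b j (just y) = upper⁻⁺ b j y

module _ {n} (t : Vec ℤ n) where

  fixedCrossings : ℕ → ℕ → ℕ
  fixedCrossings i j = fixedCrossingsBy i (nonnegPart t i) j (nonnegPart t j)

  upperHits : ℕ → ℕ
  upperHits b = ∑[ j ∈ range n ] upperHitBy b j (nonnegPart t j)

  inversion : ℕ → ℕ → ℕ
  inversion i j = 𝟙 ((i <ᵇ j) ∧ (∣ val t j ∣ <ᵇ ∣ val t i ∣)) + 𝟙 ((j <ᵇ i) ∧ (∣ val t i ∣ <ᵇ ∣ val t j ∣))

  negInversions : ℕ
  negInversions = ∑[ i ∈ negList t ] ∑[ j ∈ negList t ] 𝟙 ((j <ᵇ i) ∧ (∣ val t i ∣ <ᵇ ∣ val t j ∣))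

  crossings-split : ∀ i j → crossings t i j ≡
    fixedCrossings i j + upperHitBy ∣ val t i ∣ j (nonnegPart t j) when isNeg (val t i)
                       + (crossings t i j when isNeg (val t j)) when isNeg (val t i)
  crossings-split i j = split (isNeg (val t i)) (isNeg (val t j)) refl refl
    where
    split : ∀ bi bj → isNeg (val t i) ≡ bi → isNeg (val t j) ≡ bj → crossings t i j ≡
      fixedCrossingsBy i (if bi then nothing else just (val t i)) j (if bj then nothing else just (val t j))
        + upperHitBy ∣ val t i ∣ j (if bj then nothing else just (val t j)) when bi + (crossings t i j when bj) when bi
    split false false negi negj = trans (crossings⁺⁺-at t negi negj) (sym (trans (+-identityʳ _) (+-identityʳ _)))
    split false true negi negj = crossings⁺⁻ t negi negj
    split true true _ _ = refl
    split true false negi negj = begin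
      crossings t i j                                                ≡⟨ crossings⁻⁺ t negi negj ⟩
      upper⁻⁺ (∣ val t i ∣) j (val t j) + lower⁻⁺ i j (val t j)        ≡⟨ +-comm _ (lower⁻⁺ i j (val t j)) ⟩
      lower⁻⁺ i j (val t j) + upper⁻⁺ (∣ val t i ∣) j (val t j)        ≡⟨ +-identityʳ _ ⟨
      lower⁻⁺ i j (val t j) + upper⁻⁺ (∣ val t i ∣) j (val t j) + 0    ∎
      where open ≡-Reasoning

  ∑-negList : (f : ℕ → ℕ) → ∑[ i ∈ range n ] (f i when isNeg (val t i)) ≡ ∑[ i ∈ negList t ] f i
  ∑-negList f = sym (∑-filterB _ (range n) f)

  cro-split : cro t ≡ ∑[ i ∈ range n ] ∑[ j ∈ range n ] fixedCrossings i j
                    + ∑[ i ∈ negList t ] upperHits ∣ val t i ∣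
                    + ∑[ i ∈ negList t ] ∑[ j ∈ negList t ] crossings t i j
  cro-split = begin
    cro t
      ≡⟨ cro≡∑crossings t ⟩
    ∑[ i ∈ R ] ∑[ j ∈ R ] crossings t i j
      ≡⟨ ∑-cong R (λ {i} _ → ∑-cong R (λ {j} _ → crossings-split i j)) ⟩
    ∑[ i ∈ R ] ∑[ j ∈ R ] (F i j + G i j + H i j)
      ≡⟨ ∑∑-distrib-+ R _ H ⟩
    ∑[ i ∈ R ] ∑[ j ∈ R ] (F i j + G i j) + ∑[ i ∈ R ] ∑[ j ∈ R ] H i j
      ≡⟨ cong (_+ ∑[ i ∈ R ] ∑[ j ∈ R ] H i j) (∑∑-distrib-+ R F G) ⟩
    ∑[ i ∈ R ] ∑[ j ∈ R ] F i j + ∑[ i ∈ R ] ∑[ j ∈ R ] G i j + ∑[ i ∈ R ] ∑[ j ∈ R ] H i j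
      ≡⟨ cong₂ (λ g h → ∑[ i ∈ R ] ∑[ j ∈ R ] F i j + g + h) ∑∑G ∑∑H ⟩
    ∑[ i ∈ R ] ∑[ j ∈ R ] F i j + ∑[ i ∈ negList t ] upperHits ∣ val t i ∣
                                + ∑[ i ∈ negList t ] ∑[ j ∈ negList t ] crossings t i j ∎
    where
    open ≡-Reasoning
    R = range n
    F G H : ℕ → ℕ → ℕ
    F = fixedCrossings
    G i j = upperHitBy ∣ val t i ∣ j (nonnegPart t j) when isNeg (val t i)
    H i j = (crossings t i j when isNeg (val t j)) when isNeg (val t i)
    ∑∑G : ∑[ i ∈ R ] ∑[ j ∈ R ] G i j ≡ ∑[ i ∈ negList t ] upperHits ∣ val t i ∣
    ∑∑G = trans (∑-cong R (λ {i} _ → ∑-when R (isNeg (val t i)) _)) (∑-negList (λ i → upperHits ∣ val t i ∣))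
    ∑∑H : ∑[ i ∈ R ] ∑[ j ∈ R ] H i j ≡ ∑[ i ∈ negList t ] ∑[ j ∈ negList t ] crossings t i j
    ∑∑H = trans (∑-cong R (λ {i} _ → ∑-when R (isNeg (val t i)) _))
                (trans (∑-negList _) (∑-cong (negList t) (λ {i} _ → ∑-negList (crossings t i))))

module _ {n} {t : Vec ℤ n} (t-perm : IsSignedPerm n t) where
  open Order t-perm

  private
    N : List ℕ
    N = negList t

    inversion-when-K : ∀ {i j} → i ∈ N → j ∈ N →
      𝟙 ((K j <ᵇ K i) ∧ (∣ val t i ∣ <ᵇ ∣ val t j ∣)) + 𝟙 ((K j <ᵇ K i) ∧ (i <ᵇ j))
        ≡ inversion t i j when (K j <ᵇ K i)
    inversion-when-K {i} {j} i∈ j∈ with K j <ᵇ K i in Kj<Ki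
    ... | false = refl
    ... | true with <-cmp i j
    ...   | tri≈ _ refl _ = ⊥-elim (true≢false (trans (sym Kj<Ki) (<ᵇ-irrefl (K i))))
    ...   | tri> _ _ j<i rewrite <ᵇ-false (<⇒≤ j<i) | <ᵇ-true j<i = +-identityʳ _
    ...   | tri< i<j _ _ rewrite <ᵇ-true i<j | <ᵇ-false (<⇒≤ i<j) with <-cmp ∣ val t i ∣ ∣ val t j ∣
    ...     | tri≈ _ ∣ti∣≡∣tj∣ _ = ⊥-elim (<-irrefl (∣val∣-injectiveOn-negList t-perm i∈ j∈ ∣ti∣≡∣tj∣) i<j)
    ...     | tri> _ _ ∣tj∣<∣ti∣ rewrite <ᵇ-false (<⇒≤ ∣tj∣<∣ti∣) | <ᵇ-true ∣tj∣<∣ti∣ = refl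
    ...     | tri< ∣ti∣<∣tj∣ _ _ =
      ⊥-elim (<-asym (<ᵇ-sound Kj<Ki) (K-mono (⊓-mono-< i<j ∣ti∣<∣tj∣)))

    inversion-sym : ∀ i j → inversion t i j ≡ inversion t j i
    inversion-sym i j = +-comm (𝟙 ((i <ᵇ j) ∧ (∣ val t j ∣ <ᵇ ∣ val t i ∣))) _

    inversion-below : ∀ i j → inversion t i j when (j <ᵇ i) ≡ 𝟙 ((j <ᵇ i) ∧ (∣ val t i ∣ <ᵇ ∣ val t j ∣))
    inversion-below i j with <-cmp j i
    ... | tri< j<i _ _ rewrite <ᵇ-true j<i | <ᵇ-false (<⇒≤ j<i) = refl
    ... | tri≈ _ refl _ rewrite <ᵇ-irrefl j = refl
    ... | tri> _ _ i<j rewrite <ᵇ-false (<⇒≤ i<j) = refl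

  ∑crossings⁻⁻≡negInversions : ∑[ i ∈ N ] ∑[ j ∈ N ] crossings t i j ≡ negInversions t
  ∑crossings⁻⁻≡negInversions = begin
    ∑[ i ∈ N ] ∑[ j ∈ N ] crossings t i j
      ≡⟨ ∑-cong N (λ i∈ → ∑-cong N (λ j∈ → by-K i∈ j∈)) ⟩
    ∑[ i ∈ N ] ∑[ j ∈ N ] (inversion t i j when (K j <ᵇ K i))
      ≡⟨ ∑-below-orderIndependent N (inversion t) inversion-sym K (λ i → i)
           (λ i∈ j∈ → K-injective (proj₁ (∈-negList⁻ t i∈)) (proj₁ (∈-negList⁻ t j∈))) (λ _ _ i≡j → i≡j) ⟩
    ∑[ i ∈ N ] ∑[ j ∈ N ] (inversion t i j when (j <ᵇ i))
      ≡⟨ ∑-cong N (λ {i} _ → ∑-cong N (λ {j} _ → inversion-below i j)) ⟩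
    negInversions t ∎
    where
    open ≡-Reasoning
    by-K : ∀ {i j} → i ∈ N → j ∈ N → crossings t i j ≡ inversion t i j when (K j <ᵇ K i)
    by-K {i} {j} i∈ j∈ = begin
      crossings t i j
        ≡⟨ crossings⁻⁻ t (proj₂ (∈-negList⁻ t i∈)) (proj₂ (∈-negList⁻ t j∈)) ⟩
      𝟙 ((rank t j <ᵇ rank t i) ∧ (∣ val t i ∣ <ᵇ ∣ val t j ∣)) + 𝟙 ((rank t j <ᵇ rank t i) ∧ (i <ᵇ j))
        ≡⟨ cong (λ b → 𝟙 (b ∧ (∣ val t i ∣ <ᵇ ∣ val t j ∣)) + 𝟙 (b ∧ (i <ᵇ j))) (rank-<ᵇ j∈) ⟩
      𝟙 ((K j <ᵇ K i) ∧ (∣ val t i ∣ <ᵇ ∣ val t j ∣)) + 𝟙 ((K j <ᵇ K i) ∧ (i <ᵇ j))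
        ≡⟨ inversion-when-K i∈ j∈ ⟩
      inversion t i j when (K j <ᵇ K i) ∎

negInversions-AS : ∀ {n r} {τ : Vec ℤ n} → AS n r τ → negInversions τ ≡ 0
negInversions-AS {τ = τ} τ∈AS =
  trans (∑-cong (negList τ) (λ i∈ → trans (∑-cong (negList τ) (λ j∈ → no-inversion i∈ j∈)) (∑-zero (negList τ))))
        (∑-zero (negList τ))
  where
  no-inversion : ∀ {i j} → i ∈ negList τ → j ∈ negList τ →
                 𝟙 ((j <ᵇ i) ∧ (∣ val τ i ∣ <ᵇ ∣ val τ j ∣)) ≡ 0
  no-inversion {i} {j} i∈ j∈ with j <ᵇ i in j<i
  ... | false = refl
  ... | true = cong 𝟙 (<ᵇ-false (<⇒≤ (proj₂ τ∈AS j i 1≤j (<ᵇ-sound j<i) i≤n (isNeg⇒<0 negj) (isNeg⇒<0 negi))))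
    where
    1≤j = proj₁ (proj₁ (∈-negList⁻ τ j∈))
    i≤n = proj₂ (proj₁ (∈-negList⁻ τ i∈))
    negi = proj₂ (∈-negList⁻ τ i∈)
    negj = proj₂ (∈-negList⁻ τ j∈)

module ρ-crossings {n r} (ν : Vec ℤ n) (ν∈SP : SP n r ν) where
  open ρ-on-SP ν ν∈SP

  nonnegPart-τ : ∀ {k} → k ∈[1, n ] → nonnegPart τ k ≡ nonnegPart ν k
  nonnegPart-τ {k} k∈[1,n] = trans (cong (λ b → if b then nothing else just (val τ k)) (τ-isNeg k∈[1,n])) same-value
    where
    same-value : (if isNeg (val ν k) then nothing else just (val τ k)) ≡ (if isNeg (val ν k) then nothing else just (val ν k))
    same-value with isNeg (val ν k) in neg
    ... | true = refl
    ... | false = cong just (τ-nonneg k∈[1,n] neg)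

  ∑fixedCrossings-τ : ∑[ i ∈ range n ] ∑[ j ∈ range n ] fixedCrossings τ i j
                    ≡ ∑[ i ∈ range n ] ∑[ j ∈ range n ] fixedCrossings ν i j
  ∑fixedCrossings-τ = ∑-cong (range n) (λ i∈ → ∑-cong (range n) (λ j∈ →
    cong₂ (λ x y → fixedCrossingsBy _ x _ y) (nonnegPart-τ (∈-range⁻ n i∈)) (nonnegPart-τ (∈-range⁻ n j∈))))

  upperHits-τ : ∀ b → upperHits τ b ≡ upperHits ν b
  upperHits-τ b = ∑-cong (range n) (λ j∈ → cong (upperHitBy b _) (nonnegPart-τ (∈-range⁻ n j∈)))

  ∑-∣ν∣ : ∀ (f : ℕ → ℕ) → ∑[ i ∈ N ] f ∣ val ν i ∣ ≡ ∑ B f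
  ∑-∣ν∣ f = sym (∑-bList (proj₁ ν∈SP) f)

  ∑-range-r : ∀ xs → length xs ≡ r → (f : ℕ → ℕ) → ∑ xs f ≡ ∑[ q ∈ range r ] f (nth q xs)
  ∑-range-r xs refl f = ∑-reindex xs f

  ∑-∣τ∣ : ∀ (f : ℕ → ℕ) → ∑[ i ∈ N ] f ∣ val τ i ∣ ≡ ∑ B f
  ∑-∣τ∣ f = begin
    ∑[ i ∈ N ] f ∣ val τ i ∣                    ≡⟨ ∑-cong N (λ i∈ → cong f (∣τ∣-neg i∈)) ⟩
    ∑[ i ∈ N ] f (nth (pos i) B)                ≡⟨ ∑-range-r N length-N (λ i → f (nth (pos i) B)) ⟩
    ∑[ q ∈ range r ] f (nth (pos (nth q N)) B)  ≡⟨ ∑-cong (range r) (λ q∈ → cong (λ p → f (nth p B))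
                                                                                  (pos-nth (∈-range⁻ r q∈))) ⟩
    ∑[ q ∈ range r ] f (nth q B)                ≡⟨ ∑-range-r B length-B f ⟨
    ∑ B f                                       ∎
    where open ≡-Reasoning

  negInversions-ν : negInversions ν ≡ inv σ
  negInversions-ν = begin
    ∑[ i ∈ N ] ∑[ j ∈ N ] 𝟙 ((j <ᵇ i) ∧ (∣ val ν i ∣ <ᵇ ∣ val ν j ∣))
      ≡⟨ ∑-range-r N length-N (λ i → ∑[ j ∈ N ] 𝟙 ((j <ᵇ i) ∧ (∣ val ν i ∣ <ᵇ ∣ val ν j ∣))) ⟩
    ∑[ q ∈ range r ] ∑[ j ∈ N ] 𝟙 ((j <ᵇ nth q N) ∧ (∣ val ν (nth q N) ∣ <ᵇ ∣ val ν j ∣))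
      ≡⟨ ∑-cong (range r) (λ {q} _ →
           ∑-range-r N length-N (λ j → 𝟙 ((j <ᵇ nth q N) ∧ (∣ val ν (nth q N) ∣ <ᵇ ∣ val ν j ∣)))) ⟩
    ∑[ q ∈ range r ] ∑[ q′ ∈ range r ]
      𝟙 ((nth q′ N <ᵇ nth q N) ∧ (∣ val ν (nth q N) ∣ <ᵇ ∣ val ν (nth q′ N) ∣))
      ≡⟨ ∑-cong (range r) (λ q∈ → ∑-cong (range r) (λ q′∈ →
           cong 𝟙 (by-σ (∈-range⁻ r q∈) (∈-range⁻ r q′∈)))) ⟩
    ∑[ q ∈ range r ] ∑[ q′ ∈ range r ] 𝟙 ((q′ <ᵇ q) ∧ (pv σ q <ᵇ pv σ q′))
      ≡⟨ ∑-comm (range r) (range r) _ ⟩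
    ∑[ q′ ∈ range r ] ∑[ q ∈ range r ] 𝟙 ((q′ <ᵇ q) ∧ (pv σ q <ᵇ pv σ q′))
      ≡⟨ trans (count≡∑ _ (cartesianProduct (range r) (range r))) (∑-cartesianProduct (range r) (range r) _) ⟨
    inv σ ∎
    where
    open ≡-Reasoning
    by-σ : ∀ {q q′} → q ∈[1, r ] → q′ ∈[1, r ] →
      (nth q′ N <ᵇ nth q N) ∧ (∣ val ν (nth q N) ∣ <ᵇ ∣ val ν (nth q′ N) ∣)
        ≡ (q′ <ᵇ q) ∧ (pv σ q <ᵇ pv σ q′)
    by-σ q∈ q′∈ = cong₂ _∧_
      (nth-<ᵇ N (Increasing-negList ν) (q∈[1,length-N] q′∈) (q∈[1,length-N] q∈))
      (trans (sym (indexOf-<ᵇ B (Increasing-bList ν) (∣val∣-∈-bList (proj₁ ν∈SP) (nth-N q∈))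
                                                      (∣val∣-∈-bList (proj₁ ν∈SP) (nth-N q′∈))))
             (sym (cong₂ _<ᵇ_ (σ-val q∈) (σ-val q′∈))))

  cro-ρ : cro ν ≡ cro τ + inv σ
  cro-ρ = begin
    cro ν                                               ≡⟨ cro-split ν ⟩
    F ν + U ν + ∑[ i ∈ N ] ∑[ j ∈ N ] crossings ν i j   ≡⟨ cong₂ _+_ (cong₂ _+_ (sym ∑fixedCrossings-τ) U-τ) negative-ν ⟩
    F τ + U τ + inv σ                                   ≡⟨ cong (_+ inv σ) cro-τ ⟨
    cro τ + inv σ                                       ∎
    where
    open ≡-Reasoning
    F U : Vec ℤ n → ℕ
    F t = ∑[ i ∈ range n ] ∑[ j ∈ range n ] fixedCrossings t i j
    U t = ∑[ i ∈ negList t ] upperHits t ∣ val t i ∣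
    negative-ν : ∑[ i ∈ N ] ∑[ j ∈ N ] crossings ν i j ≡ inv σ
    negative-ν = trans (∑crossings⁻⁻≡negInversions (proj₁ ν∈SP)) negInversions-ν
    U-τ : U ν ≡ U τ
    U-τ = begin
      ∑[ i ∈ N ] upperHits ν ∣ val ν i ∣          ≡⟨ trans (∑-∣ν∣ (upperHits ν)) (sym (∑-∣τ∣ (upperHits ν))) ⟩
      ∑[ i ∈ N ] upperHits ν ∣ val τ i ∣          ≡⟨ ∑-cong N (λ _ → sym (upperHits-τ _)) ⟩
      ∑[ i ∈ N ] upperHits τ ∣ val τ i ∣          ≡⟨ cong (λ xs → ∑[ i ∈ xs ] upperHits τ ∣ val τ i ∣) negList-τ ⟨
      U τ                                         ∎
    cro-τ : cro τ ≡ F τ + U τ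
    cro-τ = begin
      cro τ                   ≡⟨ cro-split τ ⟩
      F τ + U τ + _           ≡⟨ cong (F τ + U τ +_) (trans (∑crossings⁻⁻≡negInversions τ-perm) (negInversions-AS τ∈AS)) ⟩
      F τ + U τ + 0           ≡⟨ +-identityʳ _ ⟩
      F τ + U τ               ∎

ρ-injective : ∀ {n r} (ν ν′ : Vec ℤ n) → SP n r ν → SP n r ν′ → ρ n r ν ≡ ρ n r ν′ → ν ≡ ν′
ρ-injective {r = r} ν ν′ ν∈SP ν′∈SP ρν≡ρν′ = begin
  ν                        ≡⟨ ρ-on-SP.ρ⁻¹-ρ ν ν∈SP ⟨
  ρ⁻¹ (ρτ ν) (ρσ r ν)      ≡⟨ cong (λ (τ , σ) → ρ⁻¹ τ σ) ρν≡ρν′ ⟩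
  ρ⁻¹ (ρτ ν′) (ρσ r ν′)    ≡⟨ ρ-on-SP.ρ⁻¹-ρ ν′ ν′∈SP ⟩
  ν′                       ∎
  where open ≡-Reasoning

theorem6p8 : (n r : ℕ) → 1 ≤ r → r ≤ n →
      ((ν : Vec ℤ n) → SP n r ν → AS n r (proj₁ (ρ n r ν)) × IsPerm r (proj₂ (ρ n r ν)))
    × ((ν ν′ : Vec ℤ n) → SP n r ν → SP n r ν′ → ρ n r ν ≡ ρ n r ν′ → ν ≡ ν′)
    × ((τ : Vec ℤ n) (σ : Vec ℕ r) → AS n r τ → IsPerm r σ →
         ∃ λ ν → SP n r ν × ρ n r ν ≡ (τ , σ))
    × ((ν : Vec ℤ n) → SP n r ν → cro ν ≡ cro (proj₁ (ρ n r ν)) + inv (proj₂ (ρ n r ν)))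
theorem6p8 n r _ _ =
  (λ ν ν∈SP → ρ-on-SP.τ∈AS ν ν∈SP , ρ-on-SP.σ-perm ν ν∈SP) ,
  ρ-injective ,
  (λ τ σ τ∈AS σ-perm → let open ρ⁻¹-on-AS τ τ∈AS σ σ-perm in ν , ν∈SP , ρ-ν) ,
  ρ-crossings.cro-ρ
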